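{- Consider the linear-probing filter described in the context, storing a set $S\subseteq[u]$ of $n$ keys in a table of size $t\ge\frac32 n$, where $t$ is a power of two, with hash function $h:[u]\to[t]$ and signature function $s:[u]\to[2^b]$. Assume that the map $x\mapsto(h(x),s(x))$ is 5-independent (with $h(x)$ and $s(x)$ not necessarily independent of each other). Then for any given key $q\in[u]\setminus S$, the probability that $q$ is a false positive (i.e., the filter answers ``yes'' on $q$) is $O(1/2^{2b/3})$.
   Context: $[m]=\{0,\ldots,m-1\}$. The map $x\mapsto(h(x),s(x))\in[t]\times[2^b]$ is 5-independent if for any distinct $x_0,\ldots,x_4\in[u]$ and any $z_0,\ldots,z_4\in[t]\times[2^b]$, $\Pr[(h(x_i),s(x_i))=z_i\text{ for all }i]=1/(t2^b)^5$. The filter: an array $T$ indexed by $[t]$, each entry empty or containing a $b$-bit signature; initially all entries are empty. Wrap-around from $t-1$ to $0$ is ignored (scans proceed to increasing indices). To query $q$: scan the locations $h(q),h(q)+1,\ldots$ up to the first empty location; answer ``yes'' if $s(q)$ is among the signatures seen, otherwise ``no''. To insert $q$: perform the query scan; if $s(q)$ was found, do nothing; otherwise place $s(q)$ in the first empty location reached. The keys of $S$ are inserted in some arbitrary fixed order. The probability is over the random choice of $(h,s)$; the $O$ hides an absolute constant. -}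

module Defs where

open import Data.Nat using (ℕ; zero; suc; _+_; _*_; _^_; _≤_)
open import Data.Fin using (Fin; toℕ) renaming (_≟_ to _≟ᶠ_)
open import Data.Fin.Properties using (all?)
open import Data.Bool using (Bool; true; false; if_then_else_)
open import Data.Maybe using (Maybe; just; nothing)
open import Data.List using (List; []; _∷_; length; filter; drop; foldl)
open import Data.Product using (_×_; _,_; proj₁; proj₂; ∃)
open import Data.Product.Properties using (≡-dec)
open import Relation.Binary.PropositionalEquality using (_≡_)
open import Relation.Nullary using (Dec; yes; no)
open import Function.Definitions using (Injective)

HS : ℕ → ℕ → Set
HS t b = Fin t × Fin (2 ^ b)

-- A hash function x ↦ (h(x), s(x)) on keys [u].
-- (wrapped in a record only so that u, t, b are inferable)
record HashFn (u t b : ℕ) : Set where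
  constructor mkHash
  field apply : Fin u → HS t b
open HashFn public

-- A hash family: a finite multiset of hash functions, one chosen uniformly.
Family : ℕ → ℕ → ℕ → Set
Family u t b = List (HashFn u t b)

countDec : ∀ {A : Set} → ((a : A) → Bool) → List A → ℕ
countDec p [] = 0
countDec p (a ∷ as) = if p a then suc (countDec p as) else countDec p as

decToBool : ∀ {P : Set} → Dec P → Bool
decToBool (yes _) = true
decToBool (no _) = false

agrees : ∀ {u t b k} → (Fin k → Fin u) → (Fin k → HS t b) → HashFn u t b → Bool
agrees xs zs f = decToBool (all? (λ i → ≡-dec _≟ᶠ_ _≟ᶠ_ (apply f (xs i)) (zs i)))

-- 5-independence: for any j ≤ 5 distinct keys and any targets, the
-- probability (under uniform choice from F) of hitting all targets is
-- 1/(t 2^b)^j, i.e.  #{f ∈ F hitting} * (t 2^b)^j = |F|.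
FiveIndependent : ∀ {u t b} → Family u t b → Set
FiveIndependent {u} {t} {b} F =
  (j : ℕ) → j ≤ 5 → (xs : Fin j → Fin u) → Injective _≡_ _≡_ xs →
  (zs : Fin j → HS t b) →
  countDec (agrees xs zs) F * (t * 2 ^ b) ^ j ≡ length F

-- Table: cells indexed by ℕ; positions beyond the list are empty.
-- (Wrap-around ignored: scans/insertions proceed to increasing indices.)
Table : ℕ → Set
Table m = List (Maybe (Fin m))

scanRun : ∀ {m} → Table m → List (Fin m)
scanRun [] = []
scanRun (nothing ∷ _) = []
scanRun (just x ∷ T) = x ∷ scanRun T

member : ∀ {m} → Fin m → List (Fin m) → Bool
member x [] = false
member x (y ∷ ys) = if decToBool (x ≟ᶠ y) then true else member x ys

found : ∀ {m} → Table m → ℕ → Fin m → Bool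
found T i σ = member σ (scanRun (drop i T))

place : ∀ {m} → ℕ → Fin m → Table m → Table m
place zero σ [] = just σ ∷ []
place zero σ (nothing ∷ T) = just σ ∷ T
place zero σ (just x ∷ T) = just x ∷ place zero σ T
place (suc i) σ [] = nothing ∷ place i σ []
place (suc i) σ (c ∷ T) = c ∷ place i σ T

hOf : ∀ {u t b} → HashFn u t b → Fin u → ℕ
hOf f x = toℕ (proj₁ (apply f x))

sOf : ∀ {u t b} → HashFn u t b → Fin u → Fin (2 ^ b)
sOf f x = proj₂ (apply f x)

query : ∀ {u t b} → HashFn u t b → Table (2 ^ b) → Fin u → Bool
query f T q = found T (hOf f q) (sOf f q)

insert : ∀ {u t b} → HashFn u t b → Table (2 ^ b) → Fin u → Table (2 ^ b)
insert f T q = if query f T q then T else place (hOf f q) (sOf f q) T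

build : ∀ {u t b} → HashFn u t b → List (Fin u) → Table (2 ^ b)
build f S = foldl (insert f) [] S

falsePositives : ∀ {u t b} → Family u t b → List (Fin u) → Fin u → ℕ
falsePositives F S q = countDec (λ f → query f (build f S) q) F

IsPowerOfTwo : ℕ → Set
IsPowerOfTwo t = ∃ λ k → t ≡ 2 ^ k

module Submission where

-- Write s₀ = 2^⌊b/3⌋, so s₀³ ≤ 2^b ≤ 4 s₀³.  If the filter answers "yes" on q ∉ S, the scan
-- from h(q) meets a cell p holding the signature of some y ∈ S with s(y) = s(q), and the
-- stretch from min(h(q), h(y)) to p lies in a run [a, p] of the table that is "full": it
-- holds at least p + 1 - a keys hashed into it (an invariant of insertion).  Either
--  (A) the run is shorter than L = 16 s₀, so h(y) is within L of h(q): by pairwise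
--      independence this costs ≤ n · 2L/(t 2^b) ≤ 32 s₀ / 2^b; or
--  (B) its length lies in [16 s, 32 s) for a dyadic scale s = s₀ 2^i, and then one of
--      33 · 17 aligned blocks around h(q) of width (17 + w) s receives ≥ 8/9 of its width in
--      keys.  Conditioned on h(q), the number of keys in a block is a sum of 4-wise independent
--      indicators with mean ≤ 2/3 of the width; the fourth central moment of a binomial and
--      Markov's inequality bound each block by O(1/s²), and summing over scales gives O(1/s₀²).
-- So Pr[false positive] ≤ 32 s₀/2^b + O(1/s₀²) = O(2^(-2b/3)), stated without division as
-- FP³ · 2^(2b) ≤ C |F|³.

open import Defs
open import Data.Nat using (ℕ; zero; suc; _+_; _*_; _^_; _≤_; _<_; _∸_; z≤n; s≤s; _≤?_; _<?_; NonZero; >-nonZero; >-nonZero⁻¹; _/_; _%_; ∣_-_∣)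
open import Data.Nat.Properties
open import Data.Nat.DivMod using (m≡m%n+[m/n]*n; m%n<n; m*n/n≡m; m/n*n≤m; /-monoˡ-≤; m<n*o⇒m/o<n)
open import Data.Nat.Tactic.RingSolver using (solve-∀; solve)
open import Data.Fin using (Fin; toℕ) renaming (zero to fz; suc to fs; _≟_ to _≟ᶠ_)
open import Data.Fin.Properties as FinP using (all?)
open import Data.Bool using (Bool; true; false; _∧_; _∨_; if_then_else_)
open import Data.Bool.Properties using (∧-identityʳ)
open import Data.Maybe using (Maybe; just; nothing)
open import Data.List using (List; []; _∷_; length; _++_; _ʳ++_; map; lookup; reverse; drop; foldl)
open import Data.List.Properties using (length-ʳ++; map-ʳ++; ʳ++-defn; ++-identityʳ; ++-assoc)
open import Data.List.Membership.Propositional using (_∈_; _∉_)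
open import Data.List.Membership.Propositional.Properties using (∈-++⁺ˡ; ∈-++⁺ʳ)
open import Data.List.Relation.Unary.Any using (here; there)
open import Data.List.Relation.Unary.All as All using (All)
open import Data.List.Relation.Unary.All.Properties.Core using (¬Any⇒All¬)
import Data.List.Relation.Unary.AllPairs as AllPairs
open import Data.List.Relation.Unary.Unique.Propositional using (Unique)
open import Data.Product using (∃; Σ; _×_; _,_; proj₁; proj₂)
open import Data.Product.Properties using (≡-dec)
open import Data.Sum using (_⊎_; inj₁; inj₂)
open import Data.Empty using (⊥; ⊥-elim)
open import Relation.Nullary using (Dec; yes; no; ¬_)
open import Relation.Binary.PropositionalEquality

𝟙 : Bool → ℕ
𝟙 true = 1
𝟙 false = 0

𝟙≤1 : ∀ x → 𝟙 x ≤ 1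
𝟙≤1 true = ≤-refl
𝟙≤1 false = z≤n

𝟙-∧ : (x y : Bool) → 𝟙 (x ∧ y) ≡ 𝟙 x * 𝟙 y
𝟙-∧ true y = sym (+-identityʳ (𝟙 y))
𝟙-∧ false y = refl

bool-iff : {x y : Bool} → (x ≡ true → y ≡ true) → (y ≡ true → x ≡ true) → x ≡ y
bool-iff {true} {true} f g = refl
bool-iff {true} {false} f g = sym (f refl)
bool-iff {false} {true} f g = g refl
bool-iff {false} {false} f g = refl

∧-true : {x y : Bool} → x ∧ y ≡ true → (x ≡ true) × (y ≡ true)
∧-true {true} {true} e = refl , refl

∧-intro : {x y : Bool} → x ≡ true → y ≡ true → x ∧ y ≡ true
∧-intro refl refl = refl

∨-introˡ : {x y : Bool} → x ≡ true → x ∨ y ≡ true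
∨-introˡ refl = refl

∨-introʳ : {x y : Bool} → y ≡ true → x ∨ y ≡ true
∨-introʳ {true} refl = refl
∨-introʳ {false} refl = refl

not-true : {x : Bool} → ¬ (x ≡ true) → x ≡ false
not-true {true} ne = ⊥-elim (ne refl)
not-true {false} ne = refl

decToBool-true : {P : Set} {d : Dec P} → decToBool d ≡ true → P
decToBool-true {d = yes p} e = p

decToBool-intro : {P : Set} (d : Dec P) → P → decToBool d ≡ true
decToBool-intro (yes _) p = refl
decToBool-intro (no np) p = ⊥-elim (np p)

eqF : ∀ {n} → Fin n → Fin n → Bool
eqF a b = decToBool (a ≟ᶠ b)

eqF-intro : ∀ {n} {a b : Fin n} → a ≡ b → eqF a b ≡ true
eqF-intro {a = a} {b} = decToBool-intro (a ≟ᶠ b)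

eqF-true : ∀ {n} {a b : Fin n} → eqF a b ≡ true → a ≡ b
eqF-true = decToBool-true

eqF-sym : ∀ {n} (a b : Fin n) → eqF a b ≡ eqF b a
eqF-sym a b = bool-iff (λ e → eqF-intro (sym (eqF-true e))) (λ e → eqF-intro (sym (eqF-true e)))

eqF-suc : ∀ {n} (a b : Fin n) → eqF (fs a) (fs b) ≡ eqF a b
eqF-suc a b = bool-iff (λ e → eqF-intro (FinP.suc-injective (eqF-true e))) (λ e → eqF-intro (cong fs (eqF-true e)))

sumList : {A : Set} → (A → ℕ) → List A → ℕ
sumList g [] = 0
sumList g (a ∷ as) = g a + sumList g as

sumFin : (n : ℕ) → (Fin n → ℕ) → ℕ
sumFin zero g = 0
sumFin (suc n) g = g fz + sumFin n (λ i → g (fs i))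

sumBelow : ℕ → (ℕ → ℕ) → ℕ
sumBelow zero g = 0
sumBelow (suc r) g = g 0 + sumBelow r (λ i → g (suc i))

module _ {A : Set} where
  sumList-ext : {g h : A → ℕ} (xs : List A) → (∀ a → g a ≡ h a) → sumList g xs ≡ sumList h xs
  sumList-ext [] e = refl
  sumList-ext (a ∷ xs) e = cong₂ _+_ (e a) (sumList-ext xs e)

  sumList-mono : {g h : A → ℕ} (xs : List A) → (∀ a → a ∈ xs → g a ≤ h a) → sumList g xs ≤ sumList h xs
  sumList-mono [] e = z≤n
  sumList-mono (a ∷ xs) e = +-mono-≤ (e a (here refl)) (sumList-mono xs (λ b m → e b (there m)))

  sumList-+ : (g h : A → ℕ) (xs : List A) → sumList (λ a → g a + h a) xs ≡ sumList g xs + sumList h xs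
  sumList-+ g h [] = refl
  sumList-+ g h (a ∷ xs) = trans (cong (g a + h a +_) (sumList-+ g h xs)) (interchange (g a) (h a) _ _)
    where interchange : ∀ a b c d → (a + b) + (c + d) ≡ (a + c) + (b + d)
          interchange = solve-∀

  sumList-zero : (xs : List A) → sumList (λ _ → 0) xs ≡ 0
  sumList-zero [] = refl
  sumList-zero (a ∷ xs) = sumList-zero xs

  sumList-*ˡ : (c : ℕ) (g : A → ℕ) (xs : List A) → sumList (λ a → c * g a) xs ≡ c * sumList g xs
  sumList-*ˡ c g [] = sym (*-zeroʳ c)
  sumList-*ˡ c g (a ∷ xs) = trans (cong (c * g a +_) (sumList-*ˡ c g xs)) (sym (*-distribˡ-+ c (g a) (sumList g xs)))

  sumList-*ʳ : (g : A → ℕ) (c : ℕ) (xs : List A) → sumList g xs * c ≡ sumList (λ a → g a * c) xs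
  sumList-*ʳ g c xs = trans (*-comm _ c) (trans (sym (sumList-*ˡ c g xs)) (sumList-ext xs (λ a → *-comm c (g a))))

  sumList-≤const : (g : A → ℕ) (c : ℕ) (xs : List A) → (∀ a → a ∈ xs → g a ≤ c) → sumList g xs ≤ length xs * c
  sumList-≤const g c [] e = z≤n
  sumList-≤const g c (a ∷ xs) e = +-mono-≤ (e a (here refl)) (sumList-≤const g c xs (λ b m → e b (there m)))

  count-as-sum : (p : A → Bool) (xs : List A) → countDec p xs ≡ sumList (λ a → 𝟙 (p a)) xs
  count-as-sum p [] = refl
  count-as-sum p (a ∷ xs) with p a
  ... | true = cong suc (count-as-sum p xs)
  ... | false = count-as-sum p xs

  count-ext : {p q : A → Bool} (xs : List A) → (∀ a → p a ≡ q a) → countDec p xs ≡ countDec q xs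
  count-ext {p} {q} xs e =
    trans (count-as-sum p xs) (trans (sumList-ext xs (λ a → cong 𝟙 (e a))) (sym (count-as-sum q xs)))

  count-mono : {p q : A → Bool} (xs : List A) → (∀ a → p a ≡ true → q a ≡ true) → countDec p xs ≤ countDec q xs
  count-mono [] imp = z≤n
  count-mono {p} {q} (a ∷ xs) imp with p a in pa | q a in qa
  ... | true | true = s≤s (count-mono xs imp)
  ... | true | false = ⊥-elim (case (trans (sym (imp a pa)) qa))
    where case : true ≡ false → ⊥
          case ()
  ... | false | true = ≤-trans (count-mono xs imp) (n≤1+n _)
  ... | false | false = count-mono xs imp

  count-≤length : (p : A → Bool) (xs : List A) → countDec p xs ≤ length xs
  count-≤length p [] = z≤n
  count-≤length p (a ∷ xs) with p a
  ... | true = s≤s (count-≤length p xs)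
  ... | false = ≤-trans (count-≤length p xs) (n≤1+n _)

  count-++ : (p : A → Bool) (xs ys : List A) → countDec p (xs ++ ys) ≡ countDec p xs + countDec p ys
  count-++ p [] ys = refl
  count-++ p (a ∷ xs) ys with p a
  ... | true = cong suc (count-++ p xs ys)
  ... | false = count-++ p xs ys

  count-∨ : (p r : A → Bool) (xs : List A) → countDec (λ a → p a ∨ r a) xs ≤ countDec p xs + countDec r xs
  count-∨ p r [] = z≤n
  count-∨ p r (a ∷ xs) with p a | r a
  ... | true | true = s≤s (≤-trans (count-∨ p r xs) (≤-trans (n≤1+n _) (≤-reflexive (sym (+-suc _ _)))))
  ... | true | false = s≤s (count-∨ p r xs)
  ... | false | true = ≤-trans (s≤s (count-∨ p r xs)) (≤-reflexive (sym (+-suc _ _)))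
  ... | false | false = count-∨ p r xs

  count-*ʳ : (p : A → Bool) (xs : List A) (K : ℕ) → countDec p xs * K ≡ sumList (λ a → 𝟙 (p a) * K) xs
  count-*ʳ p xs K = trans (cong (_* K) (count-as-sum p xs)) (sumList-*ʳ _ K xs)

sumFin-ext : (n : ℕ) {g h : Fin n → ℕ} → (∀ i → g i ≡ h i) → sumFin n g ≡ sumFin n h
sumFin-ext zero e = refl
sumFin-ext (suc n) e = cong₂ _+_ (e fz) (sumFin-ext n (λ i → e (fs i)))

sumFin-mono : (n : ℕ) {g h : Fin n → ℕ} → (∀ i → g i ≤ h i) → sumFin n g ≤ sumFin n h
sumFin-mono zero e = z≤n
sumFin-mono (suc n) e = +-mono-≤ (e fz) (sumFin-mono n (λ i → e (fs i)))

sumFin-*ˡ : (n c : ℕ) (g : Fin n → ℕ) → sumFin n (λ i → c * g i) ≡ c * sumFin n g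
sumFin-*ˡ zero c g = sym (*-zeroʳ c)
sumFin-*ˡ (suc n) c g = trans (cong (c * g fz +_) (sumFin-*ˡ n c (λ i → g (fs i)))) (sym (*-distribˡ-+ c (g fz) _))

sumFin-*ʳ : (n : ℕ) (g : Fin n → ℕ) (c : ℕ) → sumFin n g * c ≡ sumFin n (λ i → g i * c)
sumFin-*ʳ n g c = trans (*-comm _ c) (trans (sym (sumFin-*ˡ n c g)) (sumFin-ext n (λ i → *-comm c (g i))))

sumFin-const : (n c : ℕ) → sumFin n (λ _ → c) ≡ n * c
sumFin-const zero c = refl
sumFin-const (suc n) c = cong (c +_) (sumFin-const n c)

sumFin-≤const : (n c : ℕ) (g : Fin n → ℕ) → (∀ i → g i ≤ c) → sumFin n g ≤ n * c
sumFin-≤const zero c g e = z≤n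
sumFin-≤const (suc n) c g e = +-mono-≤ (e fz) (sumFin-≤const n c _ (λ i → e (fs i)))

sumFin-+ : (n : ℕ) (g h : Fin n → ℕ) → sumFin n (λ i → g i + h i) ≡ sumFin n g + sumFin n h
sumFin-+ zero g h = refl
sumFin-+ (suc n) g h = trans (cong (g fz + h fz +_) (sumFin-+ n (λ i → g (fs i)) (λ i → h (fs i))))
                             (interchange (g fz) (h fz) _ _)
  where interchange : ∀ a b c d → (a + b) + (c + d) ≡ (a + c) + (b + d)
        interchange = solve-∀

sumList-sumFin : {A : Set} (n : ℕ) (g : A → Fin n → ℕ) (xs : List A) →
  sumList (λ a → sumFin n (g a)) xs ≡ sumFin n (λ i → sumList (λ a → g a i) xs)
sumList-sumFin n g [] = sym (trans (sumFin-const n 0) (*-zeroʳ n))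
sumList-sumFin n g (a ∷ xs) =
  trans (cong (sumFin n (g a) +_) (sumList-sumFin n g xs)) (sym (sumFin-+ n (g a) _))

sumFin-delta : (n : ℕ) (w : Fin n) (c : Fin n → ℕ) → sumFin n (λ i → 𝟙 (eqF w i) * c i) ≡ c w
sumFin-delta (suc n) fz c =
  trans (cong (c fz + 0 +_) (trans (sumFin-const n 0) (*-zeroʳ n))) (trans (+-identityʳ _) (+-identityʳ _))
sumFin-delta (suc n) (fs w) c =
  trans (sumFin-ext n (λ i → cong (λ z → 𝟙 z * c (fs i)) (eqF-suc w i))) (sumFin-delta n w (λ i → c (fs i)))

sumBelow-mono : ∀ r {g h : ℕ → ℕ} → (∀ i → g i ≤ h i) → sumBelow r g ≤ sumBelow r h
sumBelow-mono zero e = z≤n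
sumBelow-mono (suc r) e = +-mono-≤ (e 0) (sumBelow-mono r (λ i → e (suc i)))

sumBelow-*ʳ≤ : ∀ r (g : ℕ → ℕ) K c → (∀ i → g i * K ≤ c) → sumBelow r g * K ≤ r * c
sumBelow-*ʳ≤ zero g K c h = z≤n
sumBelow-*ʳ≤ (suc r) g K c h =
  ≤-trans (≤-reflexive (*-distribʳ-+ K (g 0) _)) (+-mono-≤ (h 0) (sumBelow-*ʳ≤ r (λ i → g (suc i)) K c (λ i → h (suc i))))

all-lookup : {A B : Set} {P : B → Set} (g : A → B) (L : List A) → All P (map g L) → ∀ i → P (g (lookup L i))
all-lookup g (x ∷ L) (p All.∷ ps) fz = p
all-lookup g (x ∷ L) (p All.∷ ps) (fs i) = all-lookup g L ps i

unique-lookup-injective : {A B : Set} (g : A → B) (L : List A) → Unique (map g L) →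
  ∀ i j → g (lookup L i) ≡ g (lookup L j) → i ≡ j
unique-lookup-injective g (x ∷ L) (a AllPairs.∷ u) fz fz e = refl
unique-lookup-injective g (x ∷ L) (a AllPairs.∷ u) fz (fs j) e = ⊥-elim (all-lookup g L a j e)
unique-lookup-injective g (x ∷ L) (a AllPairs.∷ u) (fs i) fz e = ⊥-elim (all-lookup g L a i (sym e))
unique-lookup-injective g (x ∷ L) (a AllPairs.∷ u) (fs i) (fs j) e = cong fs (unique-lookup-injective g L u i j e)

all-remove : {A : Set} {P : A → Set} (xs : List A) {y : A} {ys : List A} → All P (xs ++ y ∷ ys) → All P (xs ++ ys)
all-remove [] (p All.∷ ps) = ps
all-remove (x ∷ xs) (p All.∷ ps) = p All.∷ all-remove xs ps

unique-remove : {A : Set} (xs : List A) {y : A} {ys : List A} → Unique (xs ++ y ∷ ys) → Unique (xs ++ ys)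
unique-remove [] (a AllPairs.∷ u) = u
unique-remove (x ∷ xs) (a AllPairs.∷ u) = all-remove xs a AllPairs.∷ unique-remove xs u

unique-remove-ʳ++ : {A : Set} (xs : List A) {y : A} {ys : List A} → Unique (xs ʳ++ (y ∷ ys)) → Unique (xs ʳ++ ys)
unique-remove-ʳ++ xs u = subst Unique (sym (ʳ++-defn xs)) (unique-remove (reverse xs) (subst Unique (ʳ++-defn xs) u))

module Independence {u t b : ℕ} where
  N : ℕ
  N = t * 2 ^ b

  sumHS : (HS t b → ℕ) → ℕ
  sumHS g = sumFin t (λ h → sumFin (2 ^ b) (λ σ → g (h , σ)))

  sumHS-ext : {g h : HS t b → ℕ} → (∀ v → g v ≡ h v) → sumHS g ≡ sumHS h
  sumHS-ext e = sumFin-ext t (λ h → sumFin-ext (2 ^ b) (λ σ → e (h , σ)))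

  sumHS-mono : {g h : HS t b → ℕ} → (∀ v → g v ≤ h v) → sumHS g ≤ sumHS h
  sumHS-mono e = sumFin-mono t (λ h → sumFin-mono (2 ^ b) (λ σ → e (h , σ)))

  sumHS-*ˡ : (c : ℕ) (g : HS t b → ℕ) → sumHS (λ v → c * g v) ≡ c * sumHS g
  sumHS-*ˡ c g = trans (sumFin-ext t (λ h → sumFin-*ˡ (2 ^ b) c _)) (sumFin-*ˡ t c _)

  sumHS-*ʳ : (g : HS t b → ℕ) (K : ℕ) → sumHS g * K ≡ sumHS (λ v → g v * K)
  sumHS-*ʳ g K = trans (*-comm (sumHS g) K) (trans (sym (sumHS-*ˡ K g)) (sumHS-ext (λ v → *-comm K (g v))))

  sumHS-const : (c : ℕ) → sumHS (λ _ → c) ≡ N * c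
  sumHS-const c = trans (sumFin-ext t (λ h → sumFin-const (2 ^ b) c)) (trans (sumFin-const t _) (sym (*-assoc t _ c)))

  sumList-sumHS : {A : Set} (g : A → HS t b → ℕ) (xs : List A) →
    sumList (λ a → sumHS (g a)) xs ≡ sumHS (λ v → sumList (λ a → g a v) xs)
  sumList-sumHS g xs = trans (sumList-sumFin t (λ a h → sumFin (2 ^ b) (λ σ → g a (h , σ))) xs)
                             (sumFin-ext t (λ h → sumList-sumFin (2 ^ b) (λ a σ → g a (h , σ)) xs))

  eqHS : HS t b → HS t b → Bool
  eqHS w v = eqF (proj₁ w) (proj₁ v) ∧ eqF (proj₂ w) (proj₂ v)

  eqHS-true : (w v : HS t b) → eqHS w v ≡ true → w ≡ v
  eqHS-true (w1 , w2) (v1 , v2) e with ∧-true {eqF w1 v1} e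
  ... | e1 , e2 = cong₂ _,_ (eqF-true e1) (eqF-true e2)

  eqHS-intro : (w v : HS t b) → w ≡ v → eqHS w v ≡ true
  eqHS-intro (w1 , w2) .(w1 , w2) refl = ∧-intro (eqF-intro {a = w1} refl) (eqF-intro {a = w2} refl)

  eqHS-sym : (w v : HS t b) → eqHS w v ≡ eqHS v w
  eqHS-sym w v = bool-iff (λ e → eqHS-intro v w (sym (eqHS-true w v e))) (λ e → eqHS-intro w v (sym (eqHS-true v w e)))

  sumHS-delta : (w : HS t b) (c : HS t b → ℕ) → sumHS (λ v → 𝟙 (eqHS w v) * c v) ≡ c w
  sumHS-delta (w1 , w2) c =
    trans (sumFin-ext t (λ h → trans (sumFin-ext (2 ^ b) (λ σ → split (eqF w1 h) (eqF w2 σ) (c (h , σ))))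
                                (trans (sumFin-*ˡ (2 ^ b) (𝟙 (eqF w1 h)) _)
                                       (cong (𝟙 (eqF w1 h) *_) (sumFin-delta (2 ^ b) w2 (λ σ → c (h , σ)))))))
          (sumFin-delta t w1 (λ h → c (h , w2)))
    where
      split : (x y : Bool) (z : ℕ) → 𝟙 (x ∧ y) * z ≡ 𝟙 x * (𝟙 y * z)
      split x y z = trans (cong (_* z) (𝟙-∧ x y)) (*-assoc (𝟙 x) (𝟙 y) z)

  Constraint : Set
  Constraint = Fin u × (HS t b → Bool)

  Pin : Set
  Pin = Fin u × HS t b

  holds : List Constraint → HashFn u t b → Bool
  holds [] f = true
  holds ((x , P) ∷ cs) f = P (apply f x) ∧ holds cs f

  pinned : List Pin → HashFn u t b → Bool
  pinned [] f = true
  pinned ((x , v) ∷ es) f = eqHS (apply f x) v ∧ pinned es f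

  size : (HS t b → Bool) → ℕ
  size P = sumHS (λ v → 𝟙 (P v))

  weight : List Constraint → ℕ
  weight [] = 1
  weight ((x , P) ∷ cs) = size P * weight cs

  holds-ʳ++ : (xs ys : List Constraint) (f : HashFn u t b) → holds (xs ʳ++ ys) f ≡ holds xs f ∧ holds ys f
  holds-ʳ++ [] ys f = refl
  holds-ʳ++ ((x , P) ∷ xs) ys f rewrite holds-ʳ++ xs ((x , P) ∷ ys) f with P (apply f x) | holds xs f
  ... | true | true = refl
  ... | true | false = refl
  ... | false | true = refl
  ... | false | false = refl

  weight-ʳ++ : (xs ys : List Constraint) → weight (xs ʳ++ ys) ≡ weight xs * weight ys
  weight-ʳ++ [] ys = sym (+-identityʳ _)
  weight-ʳ++ ((x , P) ∷ xs) ys rewrite weight-ʳ++ xs ((x , P) ∷ ys) = rearrange (size P) (weight xs) (weight ys)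
    where rearrange : ∀ a c d → c * (a * d) ≡ (a * c) * d
          rearrange = solve-∀

  pinned-lookup : (L : List Pin) (f : HashFn u t b) →
    pinned L f ≡ true → ∀ i → apply f (proj₁ (lookup L i)) ≡ proj₂ (lookup L i)
  pinned-lookup ((x , v) ∷ L) f e fz = eqHS-true (apply f x) v (proj₁ (∧-true e))
  pinned-lookup ((x , v) ∷ L) f e (fs i) = pinned-lookup L f (proj₂ (∧-true {eqHS (apply f x) v} e)) i

  pinned-lookup⁻ : (L : List Pin) (f : HashFn u t b) →
    (∀ i → apply f (proj₁ (lookup L i)) ≡ proj₂ (lookup L i)) → pinned L f ≡ true
  pinned-lookup⁻ [] f h = refl
  pinned-lookup⁻ ((x , v) ∷ L) f h = ∧-intro (eqHS-intro (apply f x) v (h fz)) (pinned-lookup⁻ L f (λ i → h (fs i)))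

  module _ (F : Family u t b) (ind : FiveIndependent F) where

    pinned-count : (L : List Pin) → Unique (map proj₁ L) → length L ≤ 5 →
      countDec (pinned L) F * N ^ length L ≡ length F
    pinned-count L uq le =
      trans (cong (_* N ^ length L) (count-ext F (λ f → sym (agrees-pinned f))))
            (ind (length L) le xs (λ {i} {j} e → unique-lookup-injective proj₁ L uq i j e) zs)
      where
        xs : Fin (length L) → Fin u
        xs i = proj₁ (lookup L i)
        zs : Fin (length L) → HS t b
        zs i = proj₂ (lookup L i)
        agrees-pinned : (f : HashFn u t b) → agrees xs zs f ≡ pinned L f
        agrees-pinned f = bool-iff (λ e → pinned-lookup⁻ L f (decToBool-true e))
          (λ e → decToBool-intro (all? (λ i → ≡-dec _≟ᶠ_ _≟ᶠ_ (apply f (xs i)) (zs i))) (pinned-lookup L f e))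

    split-constraint : (E : List Pin) (x : Fin u) (P : HS t b → Bool) (R : List Constraint) →
      countDec (λ f → pinned E f ∧ (P (apply f x) ∧ holds R f)) F ≡
      sumHS (λ v → 𝟙 (P v) * countDec (λ f → pinned ((x , v) ∷ E) f ∧ holds R f) F)
    split-constraint E x P R =
      trans (count-as-sum _ F)
      (trans (sumList-ext F (λ f → sym (pointwise f)))
      (trans (sumList-sumHS _ F)
      (sumHS-ext (λ v → trans (sumList-*ˡ (𝟙 (P v)) _ F) (cong (𝟙 (P v) *_) (sym (count-as-sum _ F)))))))
      where
        pointwise : (f : HashFn u t b) →
          sumHS (λ v → 𝟙 (P v) * 𝟙 ((eqHS (apply f x) v ∧ pinned E f) ∧ holds R f)) ≡
          𝟙 (pinned E f ∧ (P (apply f x) ∧ holds R f))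
        pointwise f =
          trans (sumHS-ext (λ v → reorder (P v) (eqHS (apply f x) v) (pinned E f) (holds R f)))
          (trans (sumHS-delta (apply f x) (λ v → 𝟙 (P v) * 𝟙 (pinned E f ∧ holds R f)))
                 (sym (pull-out (P (apply f x)) (pinned E f) (holds R f))))
          where
            reorder : (p e s r : Bool) → 𝟙 p * 𝟙 ((e ∧ s) ∧ r) ≡ 𝟙 e * (𝟙 p * 𝟙 (s ∧ r))
            reorder p e s r rewrite 𝟙-∧ (e ∧ s) r | 𝟙-∧ e s | 𝟙-∧ s r = ring (𝟙 p) (𝟙 e) (𝟙 s) (𝟙 r)
              where ring : ∀ a c d g → a * ((c * d) * g) ≡ c * (a * (d * g))
                    ring = solve-∀
            pull-out : (p s r : Bool) → 𝟙 (s ∧ (p ∧ r)) ≡ 𝟙 p * 𝟙 (s ∧ r)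
            pull-out p s r rewrite 𝟙-∧ s (p ∧ r) | 𝟙-∧ p r | 𝟙-∧ s r = ring (𝟙 p) (𝟙 s) (𝟙 r)
              where ring : ∀ a c d → c * (a * d) ≡ a * (c * d)
                    ring = solve-∀

    product-rule : (E : List Pin) (R : List Constraint) →
      Unique (map proj₁ E ʳ++ map proj₁ R) → length E + length R ≤ 5 →
      countDec (λ f → pinned E f ∧ holds R f) F * N ^ (length E + length R) ≡ length F * weight R
    product-rule E [] uq le =
      trans (cong₂ (λ a c → a * N ^ c) (count-ext F only-pins) (sym (length-ʳ++ E)))
      (trans (pinned-count (E ʳ++ []) (subst Unique (sym (map-ʳ++ proj₁ E)) uq) (subst (_≤ 5) (sym (length-ʳ++ E)) le))
             (sym (*-identityʳ _)))
      where
        only-pins : ∀ f → pinned E f ∧ true ≡ pinned (E ʳ++ []) f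
        only-pins f = trans (∧-identityʳ (pinned E f)) (sym (trans (pinned-ʳ++ E [] f) (∧-identityʳ (pinned E f))))
          where
            pinned-ʳ++ : (xs ys : List Pin) (f : HashFn u t b) → pinned (xs ʳ++ ys) f ≡ pinned xs f ∧ pinned ys f
            pinned-ʳ++ [] ys f = refl
            pinned-ʳ++ ((x , v) ∷ xs) ys f rewrite pinned-ʳ++ xs ((x , v) ∷ ys) f with eqHS (apply f x) v | pinned xs f
            ... | true | true = refl
            ... | true | false = refl
            ... | false | true = refl
            ... | false | false = refl
    product-rule E ((x , P) ∷ R) uq le =
      trans (cong (_* N ^ (length E + suc (length R))) (split-constraint E x P R))
      (trans (sumHS-*ʳ _ _)
      (trans (sumHS-ext (λ v → trans (*-assoc (𝟙 (P v)) _ _) (cong (𝟙 (P v) *_) (pin-value v))))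
      (trans (sym (sumHS-*ʳ (λ v → 𝟙 (P v)) _))
             (rearrange (size P) (length F) (weight R)))))
      where
        rearrange : ∀ a c d → a * (c * d) ≡ c * (a * d)
        rearrange = solve-∀
        pin-value : ∀ v → countDec (λ f → pinned ((x , v) ∷ E) f ∧ holds R f) F * N ^ (length E + suc (length R))
                          ≡ length F * weight R
        pin-value v = trans (cong (λ z → countDec (λ f → pinned ((x , v) ∷ E) f ∧ holds R f) F * N ^ z) (+-suc (length E) (length R)))
                            (product-rule ((x , v) ∷ E) R uq (subst (_≤ 5) (+-suc (length E) (length R)) le))

fall : ℕ → ℕ → ℕ
fall x zero = 1
fall x (suc k) = x * fall (x ∸ 1) k

fall-sucʳ : ∀ x k → fall x (suc k) ≡ fall x k * (x ∸ k)
fall-sucʳ x zero = trans (*-identityʳ x) (sym (+-identityʳ x))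
fall-sucʳ x (suc k) =
  trans (cong (x *_) (fall-sucʳ (x ∸ 1) k))
  (trans (cong (λ z → x * (fall (x ∸ 1) k * z)) (∸-+-assoc x 1 k))
         (sym (*-assoc x (fall (x ∸ 1) k) (x ∸ suc k))))

fall-vanishes : ∀ x k → x < k → fall x k ≡ 0
fall-vanishes x (suc k) lt with m≤n⇒m<n∨m≡n (≤-pred lt)
... | inj₁ lt' = trans (fall-sucʳ x k) (cong (_* (x ∸ k)) (fall-vanishes x k lt'))
... | inj₂ refl = trans (fall-sucʳ x x) (trans (cong (fall x x *_) (n∸n≡0 x)) (*-zeroʳ (fall x x)))

fall-pascal : ∀ x k → fall (suc x) (suc k) ≡ fall x (suc k) + suc k * fall x k
fall-pascal x k with ≤-<-connex k x
... | inj₁ k≤x rewrite fall-sucʳ x k = expand (fall x k) (x ∸ k) k x (m∸n+n≡m k≤x)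
  where expand : ∀ P d k x → d + k ≡ x → suc x * P ≡ P * d + suc k * P
        expand P d k .(d + k) refl = ring P d k
          where ring : ∀ P d k → suc (d + k) * P ≡ P * d + suc k * P
                ring = solve-∀
... | inj₂ x<k rewrite fall-vanishes x k x<k | fall-vanishes x (suc k) (≤-trans x<k (n≤1+n k)) =
  trans (*-zeroʳ (suc x)) (sym (*-zeroʳ (suc k)))

-- Ordinary powers as combinations of falling factorials (Stirling numbers of the second kind).
pow2-fall : ∀ x → x ^ 2 ≡ fall x 2 + fall x 1
pow2-fall 0 = refl
pow2-fall (suc z) = ring z
  where ring : ∀ z → (1 + z) * ((1 + z) * 1) ≡ (1 + z) * (z * 1) + (1 + z) * 1
        ring = solve-∀

pow3-fall : ∀ x → x ^ 3 ≡ fall x 3 + 3 * fall x 2 + fall x 1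
pow3-fall 0 = refl
pow3-fall 1 = refl
pow3-fall (suc (suc z)) = ring z
  where ring : ∀ z → (2 + z) * ((2 + z) * ((2 + z) * 1)) ≡ (2 + z) * ((1 + z) * (z * 1)) + 3 * ((2 + z) * ((1 + z) * 1)) + (2 + z) * 1
        ring = solve-∀

pow4-fall : ∀ x → x ^ 4 ≡ fall x 4 + 6 * fall x 3 + 7 * fall x 2 + fall x 1
pow4-fall 0 = refl
pow4-fall 1 = refl
pow4-fall 2 = refl
pow4-fall (suc (suc (suc z))) = ring z
  where ring : ∀ z → (3 + z) * ((3 + z) * ((3 + z) * ((3 + z) * 1)))
                     ≡ (3 + z) * ((2 + z) * ((1 + z) * (z * 1))) + 6 * ((3 + z) * ((2 + z) * ((1 + z) * 1))) + 7 * ((3 + z) * ((2 + z) * 1)) + (3 + z) * 1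
        ring = solve-∀

pow-* : ∀ a c e → (a * c) ^ e ≡ a ^ e * c ^ e
pow-* a c zero = refl
pow-* a c (suc e) = trans (cong (a * c *_) (pow-* a c e)) (ring a c (a ^ e) (c ^ e))
  where ring : ∀ a c x y → a * c * (x * y) ≡ a * x * (c * y)
        ring = solve-∀

module Moments {u t b : ℕ} (F : Family u t b) (ind : FiveIndependent F) (I : Fin t → Bool) where
  open Independence {u} {t} {b}
  open ≡-Reasoning

  X : HashFn u t b → List (Fin u) → ℕ
  X f S = countDec (λ y → I (proj₁ (apply f y))) S

  inI : HS t b → Bool
  inI v = I (proj₁ v)

  sizeI : ℕ
  sizeI = sumFin t (λ h → 𝟙 (I h))

  size-inI : size inI ≡ sizeI * 2 ^ b
  size-inI = trans (sumFin-ext t (λ h → sumFin-const (2 ^ b) (𝟙 (I h))))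
             (trans (sumFin-*ˡ t (2 ^ b) _) (*-comm (2 ^ b) sizeI))

  -- Given constraints Ctx on keys outside S (with |Ctx| + k ≤ 5), the k-th factorial
  -- moment of X restricted to Ctx is that of the binomial with |S| trials and success
  -- probability |I|/t:  E[1_Ctx (X)_k] = Pr[Ctx] (|S|)_k (|I|/t)^k.
  factorial-moment : (Ctx : List Constraint) (S : List (Fin u)) (k : ℕ) →
    Unique (map proj₁ Ctx ʳ++ S) → length Ctx + k ≤ 5 →
    sumList (λ f → 𝟙 (holds Ctx f) * fall (X f S) k) F * N ^ (length Ctx + k) ≡
      length F * weight Ctx * fall (length S) k * (sizeI * 2 ^ b) ^ k
  factorial-moment Ctx [] zero uq le = begin
      sumList (λ f → 𝟙 (holds Ctx f) * 1) F * N ^ (length Ctx + 0)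
    ≡⟨ cong₂ (λ a c → a * N ^ c) (trans (sumList-ext F (λ f → *-identityʳ _)) (trans (sym (count-as-sum _ F))
                                   (count-ext F (λ f → sym (trans (holds-ʳ++ Ctx [] f) (∧-identityʳ _))))))
                                 (sym (length-ʳ++ Ctx {[]})) ⟩
      countDec (λ f → pinned [] f ∧ holds (Ctx ʳ++ []) f) F * N ^ (0 + length (Ctx ʳ++ []))
    ≡⟨ product-rule F ind [] (Ctx ʳ++ []) (subst Unique (sym (map-ʳ++ proj₁ Ctx)) uq) (subst (_≤ 5) (sym (length-ʳ++ Ctx {[]})) le) ⟩
      length F * weight (Ctx ʳ++ [])
    ≡⟨ cong (length F *_) (trans (weight-ʳ++ Ctx []) (*-identityʳ _)) ⟩
      length F * weight Ctx
    ≡⟨ sym (trans (*-identityʳ _) (*-identityʳ _)) ⟩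
      length F * weight Ctx * 1 * 1 ∎
  factorial-moment Ctx [] (suc k) uq le =
    trans (cong (_* N ^ (length Ctx + suc k)) (trans (sumList-ext F (λ f → *-zeroʳ (𝟙 (holds Ctx f)))) (sumList-zero F)))
          (sym (cong (_* (sizeI * 2 ^ b) ^ suc k) (*-zeroʳ (length F * weight Ctx))))
  factorial-moment Ctx (y ∷ S) zero uq le = factorial-moment Ctx S zero (unique-remove-ʳ++ (map proj₁ Ctx) uq) le
  factorial-moment Ctx (y ∷ S) (suc k) uq le = begin
      sumList (λ f → 𝟙 (holds Ctx f) * fall (X f (y ∷ S)) (suc k)) F * K
    ≡⟨ cong (_* K) (trans (sumList-ext F split-on-y) (sumList-+ without-y (λ f → suc k * with-y f) F)) ⟩
      (sumList without-y F + sumList (λ f → suc k * with-y f) F) * K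
    ≡⟨ *-distribʳ-+ K (sumList without-y F) _ ⟩
      sumList without-y F * K + sumList (λ f → suc k * with-y f) F * K
    ≡⟨ cong (sumList without-y F * K +_) (trans (cong (_* K) (sumList-*ˡ (suc k) with-y F)) (*-assoc (suc k) (sumList with-y F) K)) ⟩
      sumList without-y F * K + suc k * (sumList with-y F * K)
    ≡⟨ cong₂ (λ a c → a + suc k * c) without-y-moment with-y-moment ⟩
      length F * weight Ctx * fall (length S) (suc k) * q ^ suc k
        + suc k * (length F * (size inI * weight Ctx) * fall (length S) k * q ^ k)
    ≡⟨ cong (λ z → length F * weight Ctx * fall (length S) (suc k) * q ^ suc k
                     + suc k * (length F * (z * weight Ctx) * fall (length S) k * q ^ k)) size-inI ⟩
      length F * weight Ctx * fall (length S) (suc k) * q ^ suc k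
        + suc k * (length F * (q * weight Ctx) * fall (length S) k * q ^ k)
    ≡⟨ collect (length F) (weight Ctx) (fall (length S) (suc k)) (fall (length S) k) q (q ^ k) k ⟩
      length F * weight Ctx * (fall (length S) (suc k) + suc k * fall (length S) k) * q ^ suc k
    ≡⟨ cong (λ z → length F * weight Ctx * z * q ^ suc k) (sym (fall-pascal (length S) k)) ⟩
      length F * weight Ctx * fall (suc (length S)) (suc k) * q ^ suc k ∎
    where
      K = N ^ (length Ctx + suc k)
      q = sizeI * 2 ^ b
      without-y : HashFn u t b → ℕ
      without-y f = 𝟙 (holds Ctx f) * fall (X f S) (suc k)
      -- 1_Ctx · 1[y lands in I] · (X f S)_k: the term where y is one of the counted keys.
      with-y : HashFn u t b → ℕ
      with-y f = 𝟙 (holds ((y , inI) ∷ Ctx) f) * fall (X f S) k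
      split-on-y : (f : HashFn u t b) → 𝟙 (holds Ctx f) * fall (X f (y ∷ S)) (suc k) ≡ without-y f + suc k * with-y f
      split-on-y f with I (proj₁ (apply f y))
      ... | true rewrite fall-pascal (X f S) k = ring (𝟙 (holds Ctx f)) (fall (X f S) (suc k)) (fall (X f S) k) k
        where ring : ∀ a c d k → a * (c + suc k * d) ≡ a * c + suc k * (a * d)
              ring = solve-∀
      ... | false = sym (trans (cong (𝟙 (holds Ctx f) * fall (X f S) (suc k) +_) (*-zeroʳ (suc k))) (+-identityʳ _))
      without-y-moment : sumList without-y F * K ≡ length F * weight Ctx * fall (length S) (suc k) * q ^ suc k
      without-y-moment = factorial-moment Ctx S (suc k) (unique-remove-ʳ++ (map proj₁ Ctx) uq) le
      with-y-moment : sumList with-y F * K ≡ length F * weight ((y , inI) ∷ Ctx) * fall (length S) k * q ^ k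
      with-y-moment = trans (cong (λ z → sumList with-y F * N ^ z) (+-suc (length Ctx) k))
                            (factorial-moment ((y , inI) ∷ Ctx) S k uq (subst (_≤ 5) (+-suc (length Ctx) k) le))
      collect : ∀ L P A B q Q k → L * P * A * (q * Q) + suc k * (L * (q * P) * B * Q) ≡ L * P * (A + suc k * B) * (q * Q)
      collect = solve-∀

-- (a - c)^4 expanded with all subtractions moved to the other side.
distance-fourth-power : ∀ a c → ∣ a - c ∣ ^ 4 + 4 * a ^ 3 * c + 4 * a * c ^ 3 ≡ a ^ 4 + 6 * a ^ 2 * c ^ 2 + c ^ 4
distance-fourth-power a c with ≤-total c a
... | inj₁ c≤a rewrite m≤n⇒∣n-m∣≡n∸m c≤a = subst (λ a → (a ∸ c) ^ 4 + 4 * a ^ 3 * c + 4 * a * c ^ 3 ≡ a ^ 4 + 6 * a ^ 2 * c ^ 2 + c ^ 4)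
                                                   (m+[n∸m]≡n c≤a) (above c (a ∸ c))
  where
    above : ∀ c e → (c + e ∸ c) ^ 4 + 4 * (c + e) ^ 3 * c + 4 * (c + e) * c ^ 3 ≡ (c + e) ^ 4 + 6 * (c + e) ^ 2 * c ^ 2 + c ^ 4
    above c e rewrite m+n∸m≡n c e = ring c e
      where ring : ∀ c e → e * (e * (e * (e * 1))) + 4 * ((c + e) * ((c + e) * ((c + e) * 1))) * c + 4 * (c + e) * (c * (c * (c * 1)))
                        ≡ (c + e) * ((c + e) * ((c + e) * ((c + e) * 1))) + 6 * ((c + e) * ((c + e) * 1)) * (c * (c * 1)) + c * (c * (c * (c * 1)))
            ring = solve-∀
... | inj₂ a≤c rewrite m≤n⇒∣m-n∣≡n∸m a≤c = subst (λ c → (c ∸ a) ^ 4 + 4 * a ^ 3 * c + 4 * a * c ^ 3 ≡ a ^ 4 + 6 * a ^ 2 * c ^ 2 + c ^ 4)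
                                                   (m+[n∸m]≡n a≤c) (below a (c ∸ a))
  where
    below : ∀ a e → (a + e ∸ a) ^ 4 + 4 * a ^ 3 * (a + e) + 4 * a * (a + e) ^ 3 ≡ a ^ 4 + 6 * a ^ 2 * (a + e) ^ 2 + (a + e) ^ 4
    below a e rewrite m+n∸m≡n a e = ring a e
      where ring : ∀ a e → e * (e * (e * (e * 1))) + 4 * (a * (a * (a * 1))) * (a + e) + 4 * a * ((a + e) * ((a + e) * ((a + e) * 1)))
                        ≡ a * (a * (a * (a * 1))) + 6 * (a * (a * 1)) * ((a + e) * ((a + e) * 1)) + (a + e) * ((a + e) * ((a + e) * ((a + e) * 1)))
            ring = solve-∀

fourth-power-in-falls : ∀ g t c X → let d4 = ∣ t * X - c ∣ ^ 4 in
  g * d4 + ((4 * t ^ 3 * c + 4 * t * c ^ 3) * (g * fall X 1) + (12 * t ^ 3 * c) * (g * fall X 2) + (4 * t ^ 3 * c) * (g * fall X 3))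
  ≡ c ^ 4 * (g * fall X 0) + (t ^ 4 + 6 * t ^ 2 * c ^ 2) * (g * fall X 1) + (7 * t ^ 4 + 6 * t ^ 2 * c ^ 2) * (g * fall X 2)
    + (6 * t ^ 4) * (g * fall X 3) + t ^ 4 * (g * fall X 4)
fourth-power-in-falls g t c X =
  trans (collect g d4 t c X (fall X 2) (fall X 3))
  (trans (cong (λ z → g * (d4 + 4 * t ^ 3 * c * z + 4 * t * c ^ 3 * (X * 1))) (sym (pow3-fall X)))
  (trans (cong (g *_) (trans (regroup d4 t c X) (distance-fourth-power (t * X) c)))
  (trans (expand g t c X)
  (trans (cong₂ (λ z w → g * (t ^ 4 * z + 6 * t ^ 2 * c ^ 2 * w + c ^ 4))
                (pow4-fall X) (pow2-fall X))
  (distribute g t c X (fall X 2) (fall X 3) (fall X 4))))))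
  where
    d4 = ∣ t * X - c ∣ ^ 4
    collect : ∀ g d4 t c X f2 f3 → g * d4 + ((4 * (t * (t * (t * 1))) * c + 4 * t * (c * (c * (c * 1)))) * (g * (X * 1)) + (12 * (t * (t * (t * 1))) * c) * (g * f2) + (4 * (t * (t * (t * 1))) * c) * (g * f3))
         ≡ g * (d4 + 4 * (t * (t * (t * 1))) * c * (f3 + 3 * f2 + X * 1) + 4 * t * (c * (c * (c * 1))) * (X * 1))
    collect = solve-∀
    regroup : ∀ d4 t c X → d4 + 4 * (t * (t * (t * 1))) * c * (X * (X * (X * 1))) + 4 * t * (c * (c * (c * 1))) * (X * 1) ≡ d4 + 4 * ((t * X) * ((t * X) * ((t * X) * 1))) * c + 4 * (t * X) * (c * (c * (c * 1)))
    regroup = solve-∀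
    expand : ∀ g t c X → g * (((t * X) * ((t * X) * ((t * X) * ((t * X) * 1)))) + 6 * ((t * X) * ((t * X) * 1)) * (c * (c * 1)) + (c * (c * (c * (c * 1))))) ≡ g * ((t * (t * (t * (t * 1)))) * (X * (X * (X * (X * 1)))) + 6 * (t * (t * 1)) * (c * (c * 1)) * (X * (X * 1)) + (c * (c * (c * (c * 1)))))
    expand = solve-∀
    distribute : ∀ g t c X f2 f3 f4 → g * ((t * (t * (t * (t * 1)))) * (f4 + 6 * f3 + 7 * f2 + X * 1) + 6 * (t * (t * 1)) * (c * (c * 1)) * (f2 + X * 1) + (c * (c * (c * (c * 1)))))
         ≡ (c * (c * (c * (c * 1)))) * (g * 1) + ((t * (t * (t * (t * 1)))) + 6 * (t * (t * 1)) * (c * (c * 1))) * (g * (X * 1)) + (7 * (t * (t * (t * (t * 1)))) + 6 * (t * (t * 1)) * (c * (c * 1))) * (g * f2)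
           + (6 * (t * (t * (t * (t * 1))))) * (g * f3) + (t * (t * (t * (t * 1)))) * (g * f4)
    distribute = solve-∀

-- The fourth central moment of a binomial with n trials and success probability m/T
-- (r = T - m), expressed through the falling factorials f_k = (n)_k.  Powers are spelled out as
-- products (T * (T * 1) is T ^ 2) so that the ring solver can prove the instances.
BinomialFourthMoment : (n f1 f2 f3 f4 m r T : ℕ) → Set
BinomialFourthMoment n f1 f2 f3 f4 m r T =
  (((n * m) * ((n * m) * ((n * m) * ((n * m) * 1)))) * (T * (T * (T * (T * 1)))) * 1 + ((T * (T * (T * (T * 1)))) + 6 * (T * (T * 1)) * ((n * m) * ((n * m) * 1))) * (T * (T * (T * 1))) * (f1 * (m * 1))
   + (7 * (T * (T * (T * (T * 1)))) + 6 * (T * (T * 1)) * ((n * m) * ((n * m) * 1))) * (T * (T * 1)) * (f2 * (m * (m * 1))) + 6 * (T * (T * (T * (T * 1)))) * T * (f3 * (m * (m * (m * 1))))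
   + (T * (T * (T * (T * 1)))) * (f4 * (m * (m * (m * (m * 1)))))) + 6 * (T * (T * (T * (T * 1)))) * n * (m * (m * 1)) * (r * (r * 1))
  ≡ ((4 * (T * (T * (T * 1))) * (n * m) + 4 * T * ((n * m) * ((n * m) * ((n * m) * 1)))) * (T * (T * (T * 1))) * (f1 * (m * 1)) + 12 * (T * (T * (T * 1))) * (n * m) * (T * (T * 1)) * (f2 * (m * (m * 1)))
     + 4 * (T * (T * (T * 1))) * (n * m) * T * (f3 * (m * (m * (m * 1))))) + (T * (T * (T * (T * 1)))) * n * m * r * ((T * (T * 1)) + 3 * n * m * r)

binomial-fourth-moment : ∀ n m r → BinomialFourthMoment n (fall n 1) (fall n 2) (fall n 3) (fall n 4) m r (m + r)
binomial-fourth-moment 0 m r = solve (m ∷ r ∷ [])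
binomial-fourth-moment 1 m r = solve (m ∷ r ∷ [])
binomial-fourth-moment 2 m r = solve (m ∷ r ∷ [])
binomial-fourth-moment (suc (suc (suc z))) = n≥3 z
  where
    n≥3 : ∀ z m r → BinomialFourthMoment (3 + z) ((3 + z) * 1) ((3 + z) * ((2 + z) * 1)) ((3 + z) * ((2 + z) * ((1 + z) * 1)))
                                         ((3 + z) * ((2 + z) * ((1 + z) * (z * 1)))) m r (m + r)
    n≥3 z m r = solve (z ∷ m ∷ r ∷ [])

sumList-linear₃ : {A : Set} (xs : List A) (h k1 k2 k3 : A → ℕ) (c1 c2 c3 : ℕ) →
  sumList (λ f → h f + (c1 * k1 f + c2 * k2 f + c3 * k3 f)) xs ≡ sumList h xs + (c1 * sumList k1 xs + c2 * sumList k2 xs + c3 * sumList k3 xs)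
sumList-linear₃ [] h k1 k2 k3 c1 c2 c3 = solve (c1 ∷ c2 ∷ c3 ∷ [])
sumList-linear₃ (a ∷ xs) h k1 k2 k3 c1 c2 c3 rewrite sumList-linear₃ xs h k1 k2 k3 c1 c2 c3 =
  ring (h a) (k1 a) (k2 a) (k3 a) c1 c2 c3 (sumList h xs) (sumList k1 xs) (sumList k2 xs) (sumList k3 xs)
  where ring : ∀ h k1 k2 k3 c1 c2 c3 H K1 K2 K3 → h + (c1 * k1 + c2 * k2 + c3 * k3) + (H + (c1 * K1 + c2 * K2 + c3 * K3))
                 ≡ h + H + (c1 * (k1 + K1) + c2 * (k2 + K2) + c3 * (k3 + K3))
        ring = solve-∀

sumList-linear₅ : {A : Set} (xs : List A) (k0 k1 k2 k3 k4 : A → ℕ) (c0 c1 c2 c3 c4 : ℕ) →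
  sumList (λ f → c0 * k0 f + c1 * k1 f + c2 * k2 f + c3 * k3 f + c4 * k4 f) xs
    ≡ c0 * sumList k0 xs + c1 * sumList k1 xs + c2 * sumList k2 xs + c3 * sumList k3 xs + c4 * sumList k4 xs
sumList-linear₅ [] k0 k1 k2 k3 k4 c0 c1 c2 c3 c4 = solve (c0 ∷ c1 ∷ c2 ∷ c3 ∷ c4 ∷ [])
sumList-linear₅ (a ∷ xs) k0 k1 k2 k3 k4 c0 c1 c2 c3 c4 rewrite sumList-linear₅ xs k0 k1 k2 k3 k4 c0 c1 c2 c3 c4 =
  ring (k0 a) (k1 a) (k2 a) (k3 a) (k4 a) c0 c1 c2 c3 c4 (sumList k0 xs) (sumList k1 xs) (sumList k2 xs) (sumList k3 xs) (sumList k4 xs)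
  where ring : ∀ k0 k1 k2 k3 k4 c0 c1 c2 c3 c4 K0 K1 K2 K3 K4 → c0 * k0 + c1 * k1 + c2 * k2 + c3 * k3 + c4 * k4 + (c0 * K0 + c1 * K1 + c2 * K2 + c3 * K3 + c4 * K4)
                 ≡ c0 * (k0 + K0) + c1 * (k1 + K1) + c2 * (k2 + K2) + c3 * (k3 + K3) + c4 * (k4 + K4)
        ring = solve-∀

substitute-moments : ∀ (SD : ℕ) (M : ℕ → ℕ) (T Fl : ℕ) (a : ℕ → ℕ) (L1 L2 L3 R0 R1 R2 R3 R4 X6 Y : ℕ) →
  SD + (L1 * M 1 + L2 * M 2 + L3 * M 3) ≡ R0 * M 0 + R1 * M 1 + R2 * M 2 + R3 * M 3 + R4 * M 4 →
  (∀ k → k ≤ 4 → M k * T ^ suc k ≡ Fl * a k) →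
  (R0 * T ^ 4 * a 0 + R1 * T ^ 3 * a 1 + R2 * T ^ 2 * a 2 + R3 * T * a 3 + R4 * a 4) + X6
    ≡ (L1 * T ^ 3 * a 1 + L2 * T ^ 2 * a 2 + L3 * T * a 3) + Y →
  T ^ 5 * SD + Fl * X6 ≡ Fl * Y
substitute-moments SD M T Fl a L1 L2 L3 R0 R1 R2 R3 R4 X6 Y H moment poly =
  +-cancelˡ-≡ (Fl * Lsum) _ _
    (trans (swap (Fl * Lsum) (T ^ 5 * SD) (Fl * X6))
    (trans (cong (_+ Fl * X6) scaled)
    (trans (sym (*-distribˡ-+ Fl Rsum X6))
    (trans (cong (Fl *_) poly) (*-distribˡ-+ Fl Lsum Y)))))
  where
    Lsum = L1 * T ^ 3 * a 1 + L2 * T ^ 2 * a 2 + L3 * T * a 3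
    Rsum = R0 * T ^ 4 * a 0 + R1 * T ^ 3 * a 1 + R2 * T ^ 2 * a 2 + R3 * T * a 3 + R4 * a 4
    swap : ∀ a c d → a + (c + d) ≡ (c + a) + d
    swap = solve-∀
    scaled : T ^ 5 * SD + Fl * Lsum ≡ Fl * Rsum
    scaled = begin
        T ^ 5 * SD + Fl * Lsum
      ≡⟨ sym (pull-Fl T SD Fl (a 1) (a 2) (a 3) L1 L2 L3) ⟩
        T ^ 5 * SD + (L1 * T ^ 3 * (Fl * a 1) + L2 * T ^ 2 * (Fl * a 2) + L3 * T * (Fl * a 3))
      ≡⟨ cong₃ (λ x y z → T ^ 5 * SD + (L1 * T ^ 3 * x + L2 * T ^ 2 * y + L3 * T * z))
               (sym (moment 1 (s≤s z≤n))) (sym (moment 2 (s≤s (s≤s z≤n)))) (sym (moment 3 (s≤s (s≤s (s≤s z≤n))))) ⟩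
        T ^ 5 * SD + (L1 * T ^ 3 * (M 1 * T ^ 2) + L2 * T ^ 2 * (M 2 * T ^ 3) + L3 * T * (M 3 * T ^ 4))
      ≡⟨ factor-T T SD (M 1) (M 2) (M 3) L1 L2 L3 ⟩
        T ^ 5 * (SD + (L1 * M 1 + L2 * M 2 + L3 * M 3))
      ≡⟨ cong (T ^ 5 *_) H ⟩
        T ^ 5 * (R0 * M 0 + R1 * M 1 + R2 * M 2 + R3 * M 3 + R4 * M 4)
      ≡⟨ spread-T T (M 0) (M 1) (M 2) (M 3) (M 4) R0 R1 R2 R3 R4 ⟩
        R0 * T ^ 4 * (M 0 * T ^ 1) + R1 * T ^ 3 * (M 1 * T ^ 2) + R2 * T ^ 2 * (M 2 * T ^ 3) + R3 * T * (M 3 * T ^ 4) + R4 * (M 4 * T ^ 5)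
      ≡⟨ cong₅ (λ v w x y z → R0 * T ^ 4 * v + R1 * T ^ 3 * w + R2 * T ^ 2 * x + R3 * T * y + R4 * z)
               (moment 0 z≤n) (moment 1 (s≤s z≤n)) (moment 2 (s≤s (s≤s z≤n))) (moment 3 (s≤s (s≤s (s≤s z≤n)))) (moment 4 ≤-refl) ⟩
        R0 * T ^ 4 * (Fl * a 0) + R1 * T ^ 3 * (Fl * a 1) + R2 * T ^ 2 * (Fl * a 2) + R3 * T * (Fl * a 3) + R4 * (Fl * a 4)
      ≡⟨ pull-Fl₅ T Fl (a 0) (a 1) (a 2) (a 3) (a 4) R0 R1 R2 R3 R4 ⟩
        Fl * Rsum ∎
      where
        open ≡-Reasoning
        cong₃ : ∀ (g : ℕ → ℕ → ℕ → ℕ) {x x' y y' z z'} → x ≡ x' → y ≡ y' → z ≡ z' → g x y z ≡ g x' y' z'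
        cong₃ g refl refl refl = refl
        cong₅ : ∀ (g : ℕ → ℕ → ℕ → ℕ → ℕ → ℕ) {v v' w w' x x' y y' z z'} →
                v ≡ v' → w ≡ w' → x ≡ x' → y ≡ y' → z ≡ z' → g v w x y z ≡ g v' w' x' y' z'
        cong₅ g refl refl refl refl refl = refl
        pull-Fl : ∀ T SD Fl a1 a2 a3 L1 L2 L3 →
          (T * (T * (T * (T * (T * 1))))) * SD + (L1 * (T * (T * (T * 1))) * (Fl * a1) + L2 * (T * (T * 1)) * (Fl * a2) + L3 * T * (Fl * a3))
          ≡ (T * (T * (T * (T * (T * 1))))) * SD + Fl * (L1 * (T * (T * (T * 1))) * a1 + L2 * (T * (T * 1)) * a2 + L3 * T * a3)
        pull-Fl = solve-∀
        factor-T : ∀ T SD M1 M2 M3 L1 L2 L3 →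
          (T * (T * (T * (T * (T * 1))))) * SD + (L1 * (T * (T * (T * 1))) * (M1 * (T * (T * 1))) + L2 * (T * (T * 1)) * (M2 * (T * (T * (T * 1)))) + L3 * T * (M3 * (T * (T * (T * (T * 1))))))
          ≡ (T * (T * (T * (T * (T * 1))))) * (SD + (L1 * M1 + L2 * M2 + L3 * M3))
        factor-T = solve-∀
        spread-T : ∀ T M0 M1 M2 M3 M4 R0 R1 R2 R3 R4 →
          (T * (T * (T * (T * (T * 1))))) * (R0 * M0 + R1 * M1 + R2 * M2 + R3 * M3 + R4 * M4)
          ≡ R0 * (T * (T * (T * (T * 1)))) * (M0 * (T * 1)) + R1 * (T * (T * (T * 1))) * (M1 * (T * (T * 1))) + R2 * (T * (T * 1)) * (M2 * (T * (T * (T * 1))))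
            + R3 * T * (M3 * (T * (T * (T * (T * 1))))) + R4 * (M4 * (T * (T * (T * (T * (T * 1))))))
        spread-T = solve-∀
        pull-Fl₅ : ∀ T Fl a0 a1 a2 a3 a4 R0 R1 R2 R3 R4 →
          R0 * (T * (T * (T * (T * 1)))) * (Fl * a0) + R1 * (T * (T * (T * 1))) * (Fl * a1) + R2 * (T * (T * 1)) * (Fl * a2) + R3 * T * (Fl * a3) + R4 * (Fl * a4)
          ≡ Fl * (R0 * (T * (T * (T * (T * 1)))) * a0 + R1 * (T * (T * (T * 1))) * a1 + R2 * (T * (T * 1)) * a2 + R3 * T * a3 + R4 * a4)
        pull-Fl₅ = solve-∀

n≤t-from-load : ∀ n t → 3 * n ≤ 2 * t → n ≤ t
n≤t-from-load n t h with ≤-<-connex n t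
... | inj₁ p = p
... | inj₂ t<n = ⊥-elim (<⇒≱ (≤-<-trans (*-monoˡ-≤ t (s≤s (s≤s (z≤n {1})))) (*-monoʳ-< 3 t<n)) h)

markov-term : ∀ (a o : Bool) (x d : ℕ) → (o ≡ true → x ≤ 9 * d) → 𝟙 (a ∧ o) * x ^ 4 ≤ 6561 * (𝟙 a * d ^ 4)
markov-term true true x d h =
  ≤-trans (≤-reflexive (+-identityʳ (x ^ 4)))
  (≤-trans (^-monoˡ-≤ 4 (h refl)) (≤-reflexive (trans (pow-* 9 d 4) (cong (6561 *_) (sym (+-identityʳ (d ^ 4)))))))
markov-term true false x d h = z≤n
markov-term false o x d h = z≤n

module FourthMomentTail {u t b : ℕ} (F : Family u t b) (ind : FiveIndependent F) (I : Fin t → Bool)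
                        (q : Fin u) (j : Fin t) (S : List (Fin u)) (uq : Unique (q ∷ S)) where
  open Independence {u} {t} {b}
  open Moments F ind I

  atJ : HS t b → Bool
  atJ v = eqF (proj₁ v) j

  Ctx : List Constraint
  Ctx = (q , atJ) ∷ []

  n : ℕ
  n = length S

  M : ℕ → ℕ
  M k = sumList (λ f → 𝟙 (holds Ctx f) * fall (X f S) k) F

  size-atJ : size atJ ≡ 2 ^ b
  size-atJ = trans (sumFin-ext t (λ h → trans (sumFin-const (2 ^ b) (𝟙 (eqF h j)))
                                     (trans (*-comm (2 ^ b) _) (cong (λ z → 𝟙 z * 2 ^ b) (eqF-sym h j)))))
                   (sumFin-delta t j (λ _ → 2 ^ b))

  moment-at-j : ∀ k → k ≤ 4 → M k * t ^ suc k ≡ length F * (fall n k * sizeI ^ k)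
  moment-at-j k le = *-cancelʳ-≡ _ _ ((2 ^ b) ^ suc k) {{m^n≢0 (2 ^ b) (suc k) {{m^n≢0 2 b}}}} scaled
    where
      regroup : ∀ L B A Q R → L * (B * 1) * A * (Q * R) ≡ L * (A * Q) * (B * R)
      regroup = solve-∀
      scaled : M k * t ^ suc k * (2 ^ b) ^ suc k ≡ length F * (fall n k * sizeI ^ k) * (2 ^ b) ^ suc k
      scaled = trans (*-assoc (M k) _ _) (trans (cong (M k *_) (sym (pow-* t (2 ^ b) (suc k))))
               (trans (factorial-moment Ctx S k uq (s≤s le))
               (trans (cong (λ z → length F * (z * 1) * fall n k * (sizeI * 2 ^ b) ^ k) size-atJ)
               (trans (cong (λ z → length F * (2 ^ b * 1) * fall n k * z) (pow-* sizeI (2 ^ b) k))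
                      (regroup (length F) (2 ^ b) (fall n k) (sizeI ^ k) ((2 ^ b) ^ k))))))

  -- The mean of t X is c = n |I|; SD is the fourth central moment (times t^4) on h(q) = j.
  c : ℕ
  c = n * sizeI

  deviation : HashFn u t b → ℕ
  deviation f = ∣ t * X f S - c ∣

  SD : ℕ
  SD = sumList (λ f → 𝟙 (holds Ctx f) * deviation f ^ 4) F

  SD-in-moments : SD + ((4 * t ^ 3 * c + 4 * t * c ^ 3) * M 1 + (12 * t ^ 3 * c) * M 2 + (4 * t ^ 3 * c) * M 3)
      ≡ c ^ 4 * M 0 + (t ^ 4 + 6 * t ^ 2 * c ^ 2) * M 1 + (7 * t ^ 4 + 6 * t ^ 2 * c ^ 2) * M 2 + (6 * t ^ 4) * M 3 + t ^ 4 * M 4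
  SD-in-moments =
    trans (sym (sumList-linear₃ F (λ f → g f * deviation f ^ 4) (λ f → g f * fall (X f S) 1) (λ f → g f * fall (X f S) 2)
                                (λ f → g f * fall (X f S) 3) (4 * t ^ 3 * c + 4 * t * c ^ 3) (12 * t ^ 3 * c) (4 * t ^ 3 * c)))
    (trans (sumList-ext F (λ f → fourth-power-in-falls (g f) t c (X f S)))
           (sumList-linear₅ F (λ f → g f * fall (X f S) 0) (λ f → g f * fall (X f S) 1) (λ f → g f * fall (X f S) 2)
                              (λ f → g f * fall (X f S) 3) (λ f → g f * fall (X f S) 4)
                              (c ^ 4) (t ^ 4 + 6 * t ^ 2 * c ^ 2) (7 * t ^ 4 + 6 * t ^ 2 * c ^ 2) (6 * t ^ 4) (t ^ 4)))
    where g : HashFn u t b → ℕ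
          g f = 𝟙 (holds Ctx f)

  module _ (I≤t : sizeI ≤ t) where
    r : ℕ
    r = t ∸ sizeI

    Y : ℕ
    Y = t ^ 4 * n * sizeI * r * (t ^ 2 + 3 * n * sizeI * r)

    -- t^5 E[1[h(q)=j] (tX - c)^4] ≤ |F| Y: the binomial fourth central moment.
    central-fourth-moment : t ^ 5 * SD ≤ length F * Y
    central-fourth-moment = subst (t ^ 5 * SD ≤_) exact (m≤m+n _ _)
      where
        exact : t ^ 5 * SD + length F * (6 * t ^ 4 * n * sizeI ^ 2 * r ^ 2) ≡ length F * Y
        exact = substitute-moments SD M t (length F) (λ k → fall n k * sizeI ^ k)
                  (4 * t ^ 3 * c + 4 * t * c ^ 3) (12 * t ^ 3 * c) (4 * t ^ 3 * c)
                  (c ^ 4) (t ^ 4 + 6 * t ^ 2 * c ^ 2) (7 * t ^ 4 + 6 * t ^ 2 * c ^ 2) (6 * t ^ 4) (t ^ 4)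
                  (6 * t ^ 4 * n * sizeI ^ 2 * r ^ 2) Y SD-in-moments moment-at-j
                  (subst (λ T → BinomialFourthMoment n (fall n 1) (fall n 2) (fall n 3) (fall n 4) sizeI r T)
                         (m+[n∸m]≡n I≤t) (binomial-fourth-moment n sizeI r))

    module _ (B : ℕ) (1≤B : 1 ≤ B) (I≤B : sizeI ≤ B) (3n≤2t : 3 * n ≤ 2 * t) (1≤t : 1 ≤ t) where
      Overfull : HashFn u t b → Bool
      Overfull f = decToBool (8 * B ≤? 9 * X f S)

      -- Since the mean c is at most 2tB/3, overfull means deviation ≥ 2tB/9.
      overfull-deviation : ∀ f → 8 * B ≤ 9 * X f S → 2 * t * B ≤ 9 * deviation f
      overfull-deviation f over = ≤-trans gap (*-monoʳ-≤ 9 (m∸n≤∣m-n∣ (t * x) c))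
        where
          x = X f S
          ring₁ : ∀ n m → 9 * (n * m) ≡ 3 * (3 * n) * m
          ring₁ = solve-∀
          ring₂ : ∀ t B → 3 * (2 * t) * B ≡ 6 * t * B
          ring₂ = solve-∀
          ring₃ : ∀ t B → 2 * t * B + 6 * t * B ≡ t * (8 * B)
          ring₃ = solve-∀
          ring₄ : ∀ t x → t * (9 * x) ≡ 9 * (t * x)
          ring₄ = solve-∀
          mean≤ : 9 * c ≤ 6 * t * B
          mean≤ = ≤-trans (≤-reflexive (ring₁ n sizeI))
                  (≤-trans (*-mono-≤ (*-monoʳ-≤ 3 3n≤2t) I≤B) (≤-reflexive (ring₂ t B)))
          sum≤ : 2 * t * B + 9 * c ≤ 9 * (t * x)
          sum≤ = ≤-trans (+-monoʳ-≤ (2 * t * B) mean≤)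
                 (≤-trans (≤-reflexive (ring₃ t B))
                 (≤-trans (*-monoʳ-≤ t over) (≤-reflexive (ring₄ t x))))
          gap : 2 * t * B ≤ 9 * (t * x ∸ c)
          gap = subst (2 * t * B ≤_) (sym (*-distribˡ-∸ 9 (t * x) c)) (m+n≤o⇒m≤o∸n (2 * t * B) sum≤)

      markov : countDec (λ f → holds Ctx f ∧ Overfull f) F * (2 * t * B) ^ 4 ≤ 6561 * SD
      markov = ≤-trans (≤-reflexive (count-*ʳ _ F _))
               (≤-trans (sumList-mono F (λ f _ → markov-term (holds Ctx f) (Overfull f) (2 * t * B) (deviation f)
                                                          (λ e → overfull-deviation f (decToBool-true e))))
                        (≤-reflexive (sumList-*ˡ 6561 _ F)))

      Y-bound : Y ≤ t ^ 8 * (4 * (B * B))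
      Y-bound = ≤-trans (≤-reflexive (regroup t n sizeI r))
                (≤-trans (*-mono-≤ (*-monoʳ-≤ (t ^ 4) w≤W) (+-monoʳ-≤ (t ^ 2) (*-monoʳ-≤ 3 w≤W)))
                (≤-trans (≤-reflexive (collect t B)) (*-monoʳ-≤ (t ^ 8) (+-monoˡ-≤ (3 * (B * B)) (m≤m*n B B {{>-nonZero 1≤B}})))))
        where
          w≤W : n * sizeI * r ≤ t * B * t
          w≤W = *-mono-≤ (*-mono-≤ (n≤t-from-load n t 3n≤2t) I≤B) (m∸n≤m t sizeI)
          regroup : ∀ t n m r → (t * (t * (t * (t * 1)))) * n * m * r * ((t * (t * 1)) + 3 * n * m * r)
                              ≡ (t * (t * (t * (t * 1)))) * (n * m * r) * ((t * (t * 1)) + 3 * (n * m * r))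
          regroup = solve-∀
          collect : ∀ t B → (t * (t * (t * (t * 1)))) * (t * B * t) * ((t * (t * 1)) + 3 * (t * B * t))
                            ≡ (t * (t * (t * (t * (t * (t * (t * (t * 1)))))))) * (B + 3 * (B * B))
          collect = solve-∀

      tail-bound : countDec (λ f → holds Ctx f ∧ Overfull f) F * (4 * t * (B * B)) ≤ 6561 * length F
      tail-bound = *-cancelʳ-≤ _ _ (4 * t ^ 8 * (B * B)) {{nonzero}}
               (≤-trans (≤-reflexive (lhs (countDec (λ f → holds Ctx f ∧ Overfull f) F) t B))
               (≤-trans (*-monoˡ-≤ (t ^ 5) markov)
               (≤-trans (≤-reflexive (*-assoc 6561 SD (t ^ 5)))
               (≤-trans (*-monoʳ-≤ 6561 (≤-trans (≤-reflexive (*-comm SD (t ^ 5))) central-fourth-moment))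
               (≤-trans (*-monoʳ-≤ 6561 (*-monoʳ-≤ (length F) Y-bound))
                        (≤-reflexive (rhs (length F) t B)))))))
        where
          nonzero : NonZero (4 * t ^ 8 * (B * B))
          nonzero = m*n≢0 (4 * t ^ 8) (B * B) {{m*n≢0 4 (t ^ 8) {{_}} {{m^n≢0 t 8 {{>-nonZero 1≤t}}}}}}
                                               {{m*n≢0 B B {{>-nonZero 1≤B}} {{>-nonZero 1≤B}}}}
          lhs : ∀ C t B → C * (4 * t * (B * B)) * (4 * (t * (t * (t * (t * (t * (t * (t * (t * 1)))))))) * (B * B))
                          ≡ C * ((2 * t * B) * ((2 * t * B) * ((2 * t * B) * ((2 * t * B) * 1)))) * (t * (t * (t * (t * (t * 1)))))
          lhs = solve-∀
          rhs : ∀ L t B → 6561 * (L * ((t * (t * (t * (t * (t * (t * (t * (t * 1)))))))) * (4 * (B * B))))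
                          ≡ 6561 * L * (4 * (t * (t * (t * (t * (t * (t * (t * (t * 1)))))))) * (B * B))
          rhs = solve-∀

cellAt : ∀ {m} → Table m → ℕ → Maybe (Fin m)
cellAt [] p = nothing
cellAt (c ∷ T) zero = c
cellAt (c ∷ T) (suc p) = cellAt T p

Occupied : ∀ {m} → Table m → ℕ → Set
Occupied T p = ∃ λ σ → cellAt T p ≡ just σ

just≢nothing : ∀ {m} {σ : Fin m} {x : Maybe (Fin m)} → x ≡ just σ → x ≡ nothing → ⊥
just≢nothing refl ()

cellAt-drop : ∀ {m} (i : ℕ) (T : Table m) (p : ℕ) → cellAt (drop i T) p ≡ cellAt T (i + p)
cellAt-drop zero T p = refl
cellAt-drop (suc i) [] p = refl
cellAt-drop (suc i) (c ∷ T) p = cellAt-drop i T p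

scan-finds : ∀ {m} (T : Table m) (σ : Fin m) → member σ (scanRun T) ≡ true →
  ∃ λ p → cellAt T p ≡ just σ × (∀ r → r ≤ p → Occupied T r)
scan-finds [] σ ()
scan-finds (nothing ∷ T) σ ()
scan-finds (just x ∷ T) σ e with σ ≟ᶠ x
... | yes refl = 0 , refl , λ { zero _ → x , refl }
... | no _ with scan-finds T σ e
... | p , cp , occ = suc p , cp , λ { zero _ → x , refl ; (suc r) (s≤s r≤p) → occ r r≤p }

found-at : ∀ {m} (T : Table m) (i : ℕ) (σ : Fin m) → found T i σ ≡ true →
  ∃ λ p → cellAt T (i + p) ≡ just σ × (∀ r → r ≤ p → Occupied T (i + r))
found-at T i σ e with scan-finds (drop i T) σ e
... | p , cp , occ = p , trans (sym (cellAt-drop i T p)) cp ,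
      λ r r≤p → let (σ' , e') = occ r r≤p in σ' , trans (sym (cellAt-drop i T r)) e'

firstEmpty : ∀ {m} → Table m → ℕ → ℕ
firstEmpty [] i = i
firstEmpty (c ∷ T) (suc i) = suc (firstEmpty T i)
firstEmpty (nothing ∷ T) zero = 0
firstEmpty (just x ∷ T) zero = suc (firstEmpty T zero)

≤firstEmpty : ∀ {m} (T : Table m) i → i ≤ firstEmpty T i
≤firstEmpty [] i = ≤-refl
≤firstEmpty (nothing ∷ T) zero = z≤n
≤firstEmpty (just x ∷ T) zero = z≤n
≤firstEmpty (c ∷ T) (suc i) = s≤s (≤firstEmpty T i)

firstEmpty-empty : ∀ {m} (T : Table m) i → cellAt T (firstEmpty T i) ≡ nothing
firstEmpty-empty [] i = refl
firstEmpty-empty (nothing ∷ T) zero = refl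
firstEmpty-empty (just x ∷ T) zero = firstEmpty-empty T zero
firstEmpty-empty (c ∷ T) (suc i) = firstEmpty-empty T i

before-firstEmpty : ∀ {m} (T : Table m) i r → i ≤ r → r < firstEmpty T i → Occupied T r
before-firstEmpty [] i r i≤r r<i = ⊥-elim (<⇒≱ r<i i≤r)
before-firstEmpty (nothing ∷ T) zero r _ ()
before-firstEmpty (just x ∷ T) zero zero _ _ = x , refl
before-firstEmpty (just x ∷ T) zero (suc r) _ (s≤s lt) = before-firstEmpty T zero r z≤n lt
before-firstEmpty (c ∷ T) (suc i) zero () _
before-firstEmpty (c ∷ T) (suc i) (suc r) (s≤s le) (s≤s lt) = before-firstEmpty T i r le lt

place-writes : ∀ {m} (T : Table m) i σ → cellAt (place i σ T) (firstEmpty T i) ≡ just σ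
place-writes [] zero σ = refl
place-writes [] (suc i) σ = place-writes [] i σ
place-writes (nothing ∷ T) zero σ = refl
place-writes (just x ∷ T) zero σ = place-writes T zero σ
place-writes (c ∷ T) (suc i) σ = place-writes T i σ

place-keeps : ∀ {m} (T : Table m) i σ r → r ≢ firstEmpty T i → cellAt (place i σ T) r ≡ cellAt T r
place-keeps [] zero σ zero ne = ⊥-elim (ne refl)
place-keeps [] zero σ (suc r) ne = refl
place-keeps [] (suc i) σ zero ne = refl
place-keeps [] (suc i) σ (suc r) ne = place-keeps [] i σ r (λ e → ne (cong suc e))
place-keeps (nothing ∷ T) zero σ zero ne = ⊥-elim (ne refl)
place-keeps (nothing ∷ T) zero σ (suc r) ne = refl
place-keeps (just x ∷ T) zero σ zero ne = refl
place-keeps (just x ∷ T) zero σ (suc r) ne = place-keeps T zero σ r (λ e → ne (cong suc e))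
place-keeps (c ∷ T) (suc i) σ zero ne = refl
place-keeps (c ∷ T) (suc i) σ (suc r) ne = place-keeps T i σ r (λ e → ne (cong suc e))

inRange : ℕ → ℕ → ℕ → Bool
inRange lo hi x = decToBool (lo ≤? x) ∧ decToBool (x <? hi)

inRange-true : ∀ {lo hi x} → inRange lo hi x ≡ true → lo ≤ x × x < hi
inRange-true {lo} {hi} {x} e with ∧-true {decToBool (lo ≤? x)} e
... | e1 , e2 = decToBool-true e1 , decToBool-true e2

inRange-intro : ∀ {lo hi x} → lo ≤ x → x < hi → inRange lo hi x ≡ true
inRange-intro {lo} {hi} {x} p1 p2 = ∧-intro (decToBool-intro (lo ≤? x) p1) (decToBool-intro (x <? hi) p2)

interval-size : ∀ t lo hi → sumFin t (λ h → 𝟙 (inRange lo hi (toℕ h))) ≤ hi ∸ lo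
interval-size zero lo hi = z≤n
interval-size (suc t) lo hi =
  ≤-trans (+-monoʳ-≤ (𝟙 (inRange lo hi 0))
             (≤-trans (≤-reflexive (sumFin-ext t (λ h → cong 𝟙 (shift lo hi (toℕ h))))) (interval-size t (lo ∸ 1) (hi ∸ 1))))
          (first lo hi)
  where
    shift : ∀ lo hi x → inRange lo hi (suc x) ≡ inRange (lo ∸ 1) (hi ∸ 1) x
    shift lo hi x = bool-iff (λ e → let (l , h) = inRange-true {lo} {hi} e in inRange-intro (∸-monoˡ-≤ 1 l) (down hi h))
                             (λ e → let (l , h) = inRange-true {lo ∸ 1} {hi ∸ 1} e in inRange-intro (up lo l) (up' hi h))
      where
        down : ∀ hi → suc x < hi → x < hi ∸ 1
        down (suc hi) (s≤s lt) = lt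
        up : ∀ lo → lo ∸ 1 ≤ x → lo ≤ suc x
        up zero _ = z≤n
        up (suc lo) le = s≤s le
        up' : ∀ hi → x < hi ∸ 1 → suc x < hi
        up' (suc hi) lt = s≤s lt
    first : ∀ lo hi → 𝟙 (inRange lo hi 0) + ((hi ∸ 1) ∸ (lo ∸ 1)) ≤ hi ∸ lo
    first zero zero = z≤n
    first zero (suc hi) = +-monoˡ-≤ hi (𝟙≤1 _)
    first (suc lo) hi = ≤-reflexive (∸-+-assoc hi 1 lo)

interval-split-at : ∀ a p e → a ≤ p → p < e → e ∸ a ≡ p ∸ a + (e ∸ suc p) + 1
interval-split-at a p e a≤p p<e =
  +-cancelʳ-≡ a _ _ (trans (m∸n+n≡m (≤-trans a≤p (<⇒≤ p<e)))
    (sym (trans (regroup (p ∸ a) (e ∸ suc p) a)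
         (trans (cong (_+ suc (e ∸ suc p)) (m∸n+n≡m a≤p)) (trans (+-suc p (e ∸ suc p)) (m+[n∸m]≡n p<e))))))
  where regroup : ∀ x z a → x + z + 1 + a ≡ x + a + suc z
        regroup = solve-∀

module LinearProbing {u t b : ℕ} (f : HashFn u t b) where
  h : Fin u → ℕ
  h y = hOf f y

  sig : Fin u → Fin (2 ^ b)
  sig y = sOf f y

  keysIn : List (Fin u) → ℕ → ℕ → ℕ
  keysIn K a e = countDec (λ y → inRange a e (h y)) K

  keysIn-split : ∀ K a p e → a ≤ p → p ≤ e → keysIn K a e ≡ keysIn K a p + keysIn K p e
  keysIn-split K a p e a≤p p≤e =
    trans (count-as-sum _ K) (trans (sumList-ext K pointwise) (trans (sumList-+ _ _ K) (sym (cong₂ _+_ (count-as-sum _ K) (count-as-sum _ K)))))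
    where
      pointwise : ∀ y → 𝟙 (inRange a e (h y)) ≡ 𝟙 (inRange a p (h y)) + 𝟙 (inRange p e (h y))
      pointwise y with <-≤-connex (h y) p
      ... | inj₁ x<p =
        trans (cong 𝟙 (bool-iff (λ z → inRange-intro (proj₁ (inRange-true z)) x<p)
                                (λ z → inRange-intro (proj₁ (inRange-true z)) (<-≤-trans x<p p≤e))))
              (trans (sym (+-identityʳ _)) (cong (λ z → 𝟙 (inRange a p (h y)) + 𝟙 z) (sym (not-true (λ z → <⇒≱ x<p (proj₁ (inRange-true z)))))))
      ... | inj₂ p≤x =
        trans (cong 𝟙 (bool-iff (λ z → inRange-intro p≤x (proj₂ (inRange-true z)))
                                (λ z → inRange-intro (≤-trans a≤p p≤x) (proj₂ (inRange-true z)))))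
              (cong (λ z → 𝟙 z + 𝟙 (inRange p e (h y))) (sym (not-true (λ z → <⇒≱ (proj₂ (inRange-true z)) p≤x))))

  keysIn-mono : ∀ K {a a' e e'} → a' ≤ a → e ≤ e' → keysIn K a e ≤ keysIn K a' e'
  keysIn-mono K a'≤a e≤e' =
    count-mono K (λ y z → inRange-intro (≤-trans a'≤a (proj₁ (inRange-true z))) (<-≤-trans (proj₂ (inRange-true z)) e≤e'))

  Provenance : Table (2 ^ b) → List (Fin u) → Set
  Provenance T K = ∀ p σ → cellAt T p ≡ just σ →
    ∃ λ y → y ∈ K × sig y ≡ σ × h y ≤ p × (∀ r → h y ≤ r → r ≤ p → Occupied T r)

  RunStart : Table (2 ^ b) → ℕ → Set
  RunStart T a = a ≡ 0 ⊎ ∃ λ a' → a ≡ suc a' × cellAt T a' ≡ nothing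

  RunsAreFull : Table (2 ^ b) → List (Fin u) → Set
  RunsAreFull T K = ∀ a e → RunStart T a → (∀ r → a ≤ r → r < e → Occupied T r) → e ∸ a ≤ keysIn K a e

  insert-cases : ∀ T y → insert f T y ≡ T ⊎ insert f T y ≡ place (h y) (sig y) T
  insert-cases T y with query f T y
  ... | true = inj₁ refl
  ... | false = inj₂ refl

  module Placement (T : Table (2 ^ b)) (K : List (Fin u)) (y : Fin u) (prov : Provenance T K) (full : RunsAreFull T K) where
    T' : Table (2 ^ b)
    T' = place (h y) (sig y) T

    p₀ : ℕ
    p₀ = firstEmpty T (h y)

    still-occupied : ∀ r → Occupied T r → Occupied T' r
    still-occupied r (σ , e) with r ≟ p₀
    ... | yes refl = ⊥-elim (just≢nothing e (firstEmpty-empty T (h y)))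
    ... | no ne = σ , trans (place-keeps T (h y) (sig y) r ne) e

    was-occupied : ∀ r → r ≢ p₀ → Occupied T' r → Occupied T r
    was-occupied r ne (σ , e) = σ , trans (sym (place-keeps T (h y) (sig y) r ne)) e

    provenance : Provenance T' (K ++ y ∷ [])
    provenance p σ e with p ≟ p₀
    ... | yes refl = y , ∈-++⁺ʳ K (here refl) , just-injective (trans (sym (place-writes T (h y) (sig y))) e) , ≤firstEmpty T (h y) , occ
      where
        just-injective : ∀ {m} {σ σ' : Fin m} → just σ ≡ just σ' → σ ≡ σ'
        just-injective refl = refl
        occ : ∀ r → h y ≤ r → r ≤ p₀ → Occupied T' r
        occ r hy≤r r≤p₀ with m≤n⇒m<n∨m≡n r≤p₀
        ... | inj₁ r<p₀ = still-occupied r (before-firstEmpty T (h y) r hy≤r r<p₀)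
        ... | inj₂ refl = sig y , place-writes T (h y) (sig y)
    ... | no ne with prov p σ (trans (sym (place-keeps T (h y) (sig y) p ne)) e)
    ... | y' , y'∈ , s , hy'≤p , occ = y' , ∈-++⁺ˡ y'∈ , s , hy'≤p , λ r a c → still-occupied r (occ r a c)

    run-start-before : ∀ a → RunStart T' a → RunStart T a
    run-start-before a (inj₁ e) = inj₁ e
    run-start-before a (inj₂ (a' , refl , c)) with a' ≟ p₀
    ... | yes refl = ⊥-elim (just≢nothing (place-writes T (h y) (sig y)) c)
    ... | no ne = inj₂ (a' , refl , trans (sym (place-keeps T (h y) (sig y) a' ne)) c)

    keysIn-new : ∀ a e → keysIn (K ++ y ∷ []) a e ≡ keysIn K a e + 𝟙 (inRange a e (h y))
    keysIn-new a e = trans (count-++ _ K (y ∷ [])) (cong (keysIn K a e +_) (if-𝟙 (inRange a e (h y))))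
      where if-𝟙 : ∀ x → (if x then 1 else 0) ≡ 𝟙 x
            if-𝟙 true = refl
            if-𝟙 false = refl

    -- A run of T' avoiding p₀ was already a run of T.
    avoiding-p₀ : ∀ a e → RunStart T' a → (∀ r → a ≤ r → r < e → Occupied T' r) →
      (∀ r → a ≤ r → r < e → r ≢ p₀) → e ∸ a ≤ keysIn (K ++ y ∷ []) a e
    avoiding-p₀ a e rs occ avoid =
      ≤-trans (full a e (run-start-before a rs) (λ r a≤r r<e → was-occupied r (avoid r a≤r r<e) (occ r a≤r r<e)))
              (≤-trans (m≤m+n _ _) (≤-reflexive (sym (keysIn-new a e))))

    -- A run through p₀ consists of two old runs joined by p₀, and y hashes into it.
    through-p₀ : ∀ a e → RunStart T' a → (∀ r → a ≤ r → r < e → Occupied T' r) →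
      a ≤ p₀ → p₀ < e → e ∸ a ≤ keysIn (K ++ y ∷ []) a e
    through-p₀ a e rs occ a≤p₀ p₀<e =
      ≤-trans (≤-reflexive (interval-split-at a p₀ e a≤p₀ p₀<e))
      (≤-trans (+-monoˡ-≤ 1 (+-mono-≤ left (≤-trans right (keysIn-mono K (n≤1+n p₀) ≤-refl))))
               (≤-reflexive (sym (trans (keysIn-new a e) (cong₂ _+_ (keysIn-split K a p₀ e a≤p₀ (<⇒≤ p₀<e)) (cong 𝟙 y-inside))))))
      where
        rsT = run-start-before a rs
        left : p₀ ∸ a ≤ keysIn K a p₀
        left = full a p₀ rsT (λ r a≤r r<p₀ → was-occupied r (<⇒≢ r<p₀) (occ r a≤r (<-trans r<p₀ p₀<e)))
        right : e ∸ suc p₀ ≤ keysIn K (suc p₀) e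
        right = full (suc p₀) e (inj₂ (p₀ , refl , firstEmpty-empty T (h y)))
                  (λ r sp₀≤r r<e → was-occupied r (λ eq → <-irrefl (sym eq) sp₀≤r) (occ r (≤-trans a≤p₀ (<⇒≤ sp₀≤r)) r<e))
        -- h(y) cannot precede the run start a, since h(y)..p₀ is occupied in T.
        a≤hy : a ≤ h y
        a≤hy with ≤-<-connex a (h y)
        ... | inj₁ le = le
        ... | inj₂ hy<a with rsT
        ...   | inj₁ refl = ⊥-elim (<⇒≱ hy<a z≤n)
        ...   | inj₂ (a' , refl , ca') = ⊥-elim (just≢nothing (proj₂ (before-firstEmpty T (h y) a' (≤-pred hy<a) a≤p₀)) ca')
        y-inside : inRange a e (h y) ≡ true
        y-inside = inRange-intro a≤hy (≤-<-trans (≤firstEmpty T (h y)) p₀<e)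

    runs-full : RunsAreFull T' (K ++ y ∷ [])
    runs-full a e rs occ with a ≤? p₀ | p₀ <? e
    ... | yes a≤p₀ | yes p₀<e = through-p₀ a e rs occ a≤p₀ p₀<e
    ... | no a≰p₀ | _ = avoiding-p₀ a e rs occ (λ r a≤r r<e eq → a≰p₀ (subst (a ≤_) eq a≤r))
    ... | yes _ | no p₀≮e = avoiding-p₀ a e rs occ (λ r a≤r r<e eq → p₀≮e (subst (_< e) eq r<e))

  insert-preserves : ∀ T K y → Provenance T K → RunsAreFull T K →
    Provenance (insert f T y) (K ++ y ∷ []) × RunsAreFull (insert f T y) (K ++ y ∷ [])
  insert-preserves T K y prov full with insert-cases T y
  ... | inj₁ e rewrite e = (λ p σ c → let (y' , m , r) = prov p σ c in y' , ∈-++⁺ˡ m , r) ,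
                           (λ a e' rs occ → ≤-trans (full a e' rs occ) (≤-trans (m≤m+n _ _) (≤-reflexive (sym (count-++ _ K (y ∷ []))))))
  ... | inj₂ e rewrite e = Placement.provenance T K y prov full , Placement.runs-full T K y prov full

  insert-all-preserves : ∀ S' T K → Provenance T K → RunsAreFull T K →
    Provenance (foldl (insert f) T S') (K ++ S') × RunsAreFull (foldl (insert f) T S') (K ++ S')
  insert-all-preserves [] T K prov full rewrite ++-identityʳ K = prov , full
  insert-all-preserves (y ∷ S') T K prov full with insert-preserves T K y prov full
  ... | prov' , full' rewrite sym (++-assoc K (y ∷ []) S') = insert-all-preserves S' (insert f T y) (K ++ y ∷ []) prov' full'

  build-invariants : ∀ S → Provenance (build f S) S × RunsAreFull (build f S) S
  build-invariants S = insert-all-preserves S [] [] (λ p σ ()) empty-full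
    where
      empty-full : RunsAreFull [] []
      empty-full a e rs occ with a <? e
      ... | yes a<e = ⊥-elim (just≢nothing (proj₂ (occ a ≤-refl a<e)) refl)
      ... | no a≮e = ≤-reflexive (m≤n⇒m∸n≡0 (≮⇒≥ a≮e))

  run-start-of : ∀ T c → ∃ λ a → a ≤ c × RunStart T a × (∀ r → a ≤ r → r < c → Occupied T r)
  run-start-of T zero = 0 , z≤n , inj₁ refl , λ r a≤r ()
  run-start-of T (suc c) with cellAt T c in eq
  ... | nothing = suc c , ≤-refl , inj₂ (c , refl , eq) , λ r a≤r r<c → ⊥-elim (<⇒≱ r<c a≤r)
  ... | just σ with run-start-of T c
  ... | a , a≤c , rs , occ = a , ≤-trans a≤c (n≤1+n c) , rs , occ'
    where occ' : ∀ r → a ≤ r → r < suc c → Occupied T r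
          occ' r a≤r r<sc with m≤n⇒m<n∨m≡n (≤-pred r<sc)
          ... | inj₁ r<c = occ r a≤r r<c
          ... | inj₂ refl = σ , eq

  -- A false positive on q: some y ∈ S with the signature of q is stored at a cell p that the
  -- scan from h(q) reaches.  With c = min(h(q), h(y)), the whole stretch [c, p] is occupied,
  -- so it lies in a run starting at some a ≤ c, and that run [a, p] is full.
  record FalsePositiveWitness (S : List (Fin u)) (q : Fin u) : Set where
    field
      y : Fin u
      y∈S : y ∈ S
      same-sig : sig y ≡ sig q
      c p a : ℕ
      c≤hq : c ≤ h q
      hq≤p : h q ≤ p
      c≤hy : c ≤ h y
      hy≤p : h y ≤ p
      a≤c : a ≤ c
      run-full : suc p ∸ a ≤ keysIn S a (suc p)

  false-positive-witness : ∀ S q → query f (build f S) q ≡ true → FalsePositiveWitness S q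
  false-positive-witness S q yes-answer = record
    { y = y ; y∈S = y∈S ; same-sig = same-sig ; c = c ; p = p ; a = a ; c≤hq = c≤hq ; hq≤p = m≤m+n (h q) offset
    ; c≤hy = c≤hy ; hy≤p = hy≤p ; a≤c = a≤c ; run-full = run-full }
    where
      T = build f S
      scan = found-at T (h q) (sig q) yes-answer
      offset = proj₁ scan
      p = h q + offset
      owner = proj₁ (build-invariants S) p (sig q) (proj₁ (proj₂ scan))
      y = proj₁ owner
      y∈S = proj₁ (proj₂ owner)
      same-sig = proj₁ (proj₂ (proj₂ owner))
      hy≤p = proj₁ (proj₂ (proj₂ (proj₂ owner)))
      from-hq : ∀ r → h q ≤ r → r ≤ p → Occupied T r
      from-hq r hq≤r r≤p = subst (Occupied T) (m+[n∸m]≡n hq≤r)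
        (proj₂ (proj₂ scan) (r ∸ h q) (≤-trans (∸-monoˡ-≤ (h q) r≤p) (≤-reflexive (m+n∸m≡n (h q) offset))))
      lower-end : ∃ λ c → c ≤ h q × c ≤ h y × (∀ r → c ≤ r → r ≤ p → Occupied T r)
      lower-end with ≤-<-connex (h y) (h q)
      ... | inj₁ hy≤hq = h y , hy≤hq , ≤-refl , proj₂ (proj₂ (proj₂ (proj₂ owner)))
      ... | inj₂ hq<hy = h q , ≤-refl , <⇒≤ hq<hy , from-hq
      c = proj₁ lower-end
      c≤hq = proj₁ (proj₂ lower-end)
      c≤hy = proj₁ (proj₂ (proj₂ lower-end))
      start = run-start-of T c
      a = proj₁ start
      a≤c = proj₁ (proj₂ start)
      run-full : suc p ∸ a ≤ keysIn S a (suc p)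
      run-full = proj₂ (build-invariants S) a (suc p) (proj₁ (proj₂ (proj₂ start))) occupied
        where occupied : ∀ r → a ≤ r → r < suc p → Occupied T r
              occupied r a≤r r<sp with <-≤-connex r c
              ... | inj₁ r<c = proj₂ (proj₂ (proj₂ start)) r a≤r r<c
              ... | inj₂ c≤r = proj₂ (proj₂ (proj₂ lower-end)) r c≤r (≤-pred r<sp)

anyOf : {A B : Set} → (B → A → Bool) → List B → A → Bool
anyOf R [] a = false
anyOf R (y ∷ ys) a = R y a ∨ anyOf R ys a

anyOf-intro : {A B : Set} (R : B → A → Bool) (ys : List B) (a : A) (y : B) → y ∈ ys → R y a ≡ true → anyOf R ys a ≡ true
anyOf-intro R (y ∷ ys) a .y (here refl) e = ∨-introˡ e
anyOf-intro R (z ∷ ys) a y (there m) e = ∨-introʳ {R z a} (anyOf-intro R ys a y m e)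

union-bound : {A B : Set} (R : B → A → Bool) (ys : List B) (xs : List A) →
  countDec (anyOf R ys) xs ≤ sumList (λ y → countDec (R y) xs) ys
union-bound R [] xs = ≤-reflexive (trans (count-as-sum _ xs) (sumList-zero xs))
union-bound R (y ∷ ys) xs = ≤-trans (count-∨ (R y) (anyOf R ys) xs) (+-monoʳ-≤ _ (union-bound R ys xs))

anyBelow : {A : Set} → ℕ → (ℕ → A → Bool) → A → Bool
anyBelow zero R a = false
anyBelow (suc r) R a = R 0 a ∨ anyBelow r (λ i → R (suc i)) a

anyBelow-intro : {A : Set} (r : ℕ) (R : ℕ → A → Bool) (a : A) (i : ℕ) → i < r → R i a ≡ true → anyBelow r R a ≡ true
anyBelow-intro (suc r) R a zero _ e = ∨-introˡ e
anyBelow-intro (suc r) R a (suc i) (s≤s lt) e = ∨-introʳ {R 0 a} (anyBelow-intro r (λ i → R (suc i)) a i lt e)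

union-bound-below : {A : Set} (r : ℕ) (R : ℕ → A → Bool) (xs : List A) →
  countDec (anyBelow r R) xs ≤ sumBelow r (λ i → countDec (R i) xs)
union-bound-below zero R xs = ≤-reflexive (trans (count-as-sum _ xs) (sumList-zero xs))
union-bound-below (suc r) R xs =
  ≤-trans (count-∨ (R 0) (anyBelow r (λ i → R (suc i))) xs) (+-monoʳ-≤ _ (union-bound-below r (λ i → R (suc i)) xs))

geometric-sum : ∀ r (c : ℕ → ℕ) D K → (∀ i → c i * 4 ^ i * D ≤ K) → 3 * D * sumBelow r c ≤ 4 * K
geometric-sum zero c D K h = ≤-trans (≤-reflexive (*-zeroʳ (3 * D))) z≤n
geometric-sum (suc r) c D K h =
  ≤-trans (≤-reflexive (split D (c 0) (sumBelow r (λ i → c (suc i)))))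
          (≤-trans (+-mono-≤ (*-monoʳ-≤ 3 (h 0)) tail) (≤-reflexive (three-plus-one K)))
  where
    split : ∀ D x y → 3 * D * (x + y) ≡ 3 * (x * 1 * D) + 3 * D * y
    split = solve-∀
    three-plus-one : ∀ K → 3 * K + K ≡ 4 * K
    three-plus-one = solve-∀
    shift : ∀ x y D → x * y * (4 * D) ≡ x * (4 * y) * D
    shift = solve-∀
    times4 : ∀ D y → 4 * (3 * D * y) ≡ 3 * (4 * D) * y
    times4 = solve-∀
    -- The tail is the same sum with D replaced by 4D.
    tail : 3 * D * sumBelow r (λ i → c (suc i)) ≤ K
    tail = *-cancelˡ-≤ 4 (≤-trans (≤-reflexive (times4 D (sumBelow r (λ i → c (suc i)))))
             (geometric-sum r (λ i → c (suc i)) (4 * D) K (λ i → ≤-trans (≤-reflexive (shift (c (suc i)) (4 ^ i) D)) (h (suc i)))))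

module NearbyCollision {u t b : ℕ} (F : Family u t b) (ind : FiveIndependent F) (S : List (Fin u))
                       (q : Fin u) (q∉S : q ∉ S) (L : ℕ) (1≤t : 1 ≤ t) where
  open Independence {u} {t} {b}

  near : Fin u → HashFn u t b → Bool
  near y f = eqF (sOf f y) (sOf f q) ∧ inRange (hOf f q + 1 ∸ L) (hOf f q + L) (hOf f y)

  event : HashFn u t b → Bool
  event = anyOf near S

  nearTo : HS t b → HS t b → Bool
  nearTo w v = eqF (proj₂ v) (proj₂ w) ∧ inRange (toℕ (proj₁ w) + 1 ∸ L) (toℕ (proj₁ w) + L) (toℕ (proj₁ v))

  constraints : Fin u → HS t b → List Constraint
  constraints y w = (q , (λ v → eqHS v w)) ∷ (y , nearTo w) ∷ []

  near-by-q's-value : ∀ y → countDec (near y) F ≡ sumHS (λ w → countDec (holds (constraints y w)) F)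
  near-by-q's-value y = trans (count-as-sum _ F) (trans (sumList-ext F pointwise)
                        (trans (sumList-sumHS _ F) (sumHS-ext (λ w → sym (count-as-sum _ F)))))
    where
      pointwise : ∀ f → 𝟙 (near y f) ≡ sumHS (λ w → 𝟙 (holds (constraints y w) f))
      pointwise f = sym (trans (sumHS-ext (λ w → trans (𝟙-∧ (eqHS (apply f q) w) (nearTo w (apply f y) ∧ true))
                                                      (cong (λ z → 𝟙 (eqHS (apply f q) w) * 𝟙 z) (∧-identityʳ _))))
                        (sumHS-delta (apply f q) (λ w → 𝟙 (nearTo w (apply f y)))))

  size-point : ∀ w → size (λ v → eqHS v w) ≡ 1
  size-point w = trans (sumHS-ext (λ v → trans (cong 𝟙 (eqHS-sym v w)) (sym (*-identityʳ _)))) (sumHS-delta w (λ _ → 1))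

  -- One signature value, and a window of 2L - 1 locations.
  size-nearTo : ∀ w → size (nearTo w) ≤ 2 * L
  size-nearTo w =
    ≤-trans (≤-reflexive (sumFin-ext t (λ h → trans (sumFin-ext (2 ^ b) (λ σ → trans (𝟙-∧ (eqF σ (proj₂ w)) _)
                                                              (cong (λ z → 𝟙 z * 𝟙 (inRange lo hi (toℕ h))) (eqF-sym σ (proj₂ w)))))
                                               (sumFin-delta (2 ^ b) (proj₂ w) (λ _ → 𝟙 (inRange lo hi (toℕ h)))))))
    (≤-trans (interval-size t lo hi)
             (m≤n+o⇒m∸n≤o hi lo (≤-trans (+-monoˡ-≤ L (m≤m+n j 1)) (≤-trans (+-monoˡ-≤ L (m≤n+m∸n (j + 1) L)) (≤-reflexive (ring L lo))))))
    where
      j = toℕ (proj₁ w)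
      lo = j + 1 ∸ L
      hi = j + L
      ring : ∀ L x → L + x + L ≡ x + 2 * L
      ring = solve-∀

  near-bound : ∀ y → y ∈ S → countDec (near y) F * N ≤ 2 * L * length F
  near-bound y y∈S = *-cancelʳ-≤ _ _ N {{nonzero}} (≤-trans (≤-reflexive by-value) (≤-trans (sumHS-mono per-value) (≤-reflexive total)))
    where
      nonzero : NonZero N
      nonzero = m*n≢0 t (2 ^ b) {{>-nonZero 1≤t}} {{m^n≢0 2 b}}
      q≢y : q ≢ y
      q≢y refl = q∉S y∈S
      distinct : Unique (q ∷ y ∷ [])
      distinct = (q≢y All.∷ All.[]) AllPairs.∷ (All.[] AllPairs.∷ AllPairs.[])
      by-value : countDec (near y) F * N * N ≡ sumHS (λ w → countDec (holds (constraints y w)) F * (N * (N * 1)))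
      by-value = trans (cong (λ z → z * N * N) (near-by-q's-value y))
                 (trans (*-assoc (sumHS (λ w → countDec (holds (constraints y w)) F)) N N)
                 (trans (cong (λ z → sumHS (λ w → countDec (holds (constraints y w)) F) * (N * z)) (sym (*-identityʳ N)))
                        (sumHS-*ʳ _ _)))
      per-value : ∀ w → countDec (holds (constraints y w)) F * (N * (N * 1)) ≤ length F * (2 * L)
      per-value w = ≤-trans (≤-reflexive (product-rule F ind [] (constraints y w) distinct (s≤s (s≤s z≤n))))
                    (*-monoʳ-≤ (length F) (≤-trans (≤-reflexive (trans (cong (_* (size (nearTo w) * 1)) (size-point w))
                                                                (trans (+-identityʳ _) (*-identityʳ _))))
                                                   (size-nearTo w)))
      total : sumHS (λ w → length F * (2 * L)) ≡ 2 * L * length F * N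
      total = trans (sumHS-const _) (ring N (length F) L)
        where ring : ∀ N F L → N * (F * (2 * L)) ≡ 2 * L * F * N
              ring = solve-∀

  event-bound : length S ≤ t → countDec event F * 2 ^ b ≤ 2 * L * length F
  event-bound n≤t = *-cancelˡ-≤ t {{>-nonZero 1≤t}}
    (≤-trans (≤-reflexive (ring t (countDec event F) (2 ^ b)))
    (≤-trans (*-monoˡ-≤ N (union-bound near S F))
    (≤-trans (≤-reflexive (sumList-*ʳ _ N S))
    (≤-trans (sumList-≤const _ (2 * L * length F) S near-bound)
             (*-monoˡ-≤ (2 * L * length F) n≤t)))))
    where
      ring : ∀ t C B → t * (C * B) ≡ C * (t * B)
      ring = solve-∀

module OverfullBlock {u t b : ℕ} (F : Family u t b) (ind : FiveIndependent F) (S : List (Fin u)) (q : Fin u)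
                     (uq : Unique (q ∷ S)) (3n≤2t : 3 * length S ≤ 2 * t) (1≤t : 1 ≤ t)
                     (s o w : ℕ) .{{_ : NonZero s}} where
  open Independence {u} {t} {b}

  blockStart : ℕ → ℕ
  blockStart j = (j / s ∸ o) * s

  width : ℕ
  width = (17 + w) * s

  block : Fin t → Fin t → Bool
  block j h = inRange (blockStart (toℕ j)) (blockStart (toℕ j) + width) (toℕ h)

  overfullAt : Fin t → HashFn u t b → Bool
  overfullAt j f = decToBool (8 * width ≤? 9 * Moments.X F ind (block j) f S)

  event : HashFn u t b → Bool
  event f = overfullAt (proj₁ (apply f q)) f

  by-location : countDec event F ≡ sumFin t (λ j → countDec (λ f → (eqF (proj₁ (apply f q)) j ∧ true) ∧ overfullAt j f) F)
  by-location = trans (count-as-sum _ F) (trans (sumList-ext F pointwise) (trans (sumList-sumFin t _ F) (sumFin-ext t (λ j → sym (count-as-sum _ F)))))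
    where
      pointwise : ∀ f → 𝟙 (event f) ≡ sumFin t (λ j → 𝟙 ((eqF (proj₁ (apply f q)) j ∧ true) ∧ overfullAt j f))
      pointwise f = sym (trans (sumFin-ext t (λ j → trans (𝟙-∧ (eqF (proj₁ (apply f q)) j ∧ true) (overfullAt j f))
                                                       (cong (λ z → 𝟙 z * 𝟙 (overfullAt j f)) (∧-identityʳ (eqF (proj₁ (apply f q)) j)))))
                         (sumFin-delta t (proj₁ (apply f q)) (λ j → 𝟙 (overfullAt j f))))

  1≤width : 1 ≤ width
  1≤width = ≤-trans (>-nonZero⁻¹ s) (m≤n*m s (17 + w))

  -- For a fixed location j of q, the block is a fixed interval: apply the fourth-moment tail bound.
  at-location : ∀ j → countDec (λ f → (eqF (proj₁ (apply f q)) j ∧ true) ∧ overfullAt j f) F * (4 * t * (width * width))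
                        ≤ 6561 * length F
  at-location j = FourthMomentTail.tail-bound F ind (block j) q j S uq block≤t width 1≤width block≤width 3n≤2t 1≤t
    where
      block≤t : sumFin t (λ h → 𝟙 (block j h)) ≤ t
      block≤t = ≤-trans (sumFin-≤const t 1 _ (λ h → 𝟙≤1 _)) (≤-reflexive (*-identityʳ t))
      block≤width : sumFin t (λ h → 𝟙 (block j h)) ≤ width
      block≤width = ≤-trans (interval-size t (blockStart (toℕ j)) (blockStart (toℕ j) + width))
                            (≤-reflexive (m+n∸m≡n (blockStart (toℕ j)) width))

  event-bound-width : countDec event F * (4 * (width * width)) ≤ 6561 * length F
  event-bound-width = *-cancelˡ-≤ t {{>-nonZero 1≤t}}
     (≤-trans (≤-reflexive (ring t (countDec event F) (width * width)))
     (≤-trans (≤-reflexive (cong (_* (4 * t * (width * width))) by-location))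
     (≤-trans (≤-reflexive (sumFin-*ʳ t _ (4 * t * (width * width))))
              (sumFin-≤const t (6561 * length F) _ at-location))))
    where
      ring : ∀ t C X → t * (C * (4 * X)) ≡ C * (4 * t * X)
      ring = solve-∀

  -- Pr[B(s, o, w)] ≤ 6 / s², as width ≥ 17 s and 6561 ≤ 6 · 4 · 17².
  event-bound : countDec event F * (s * s) ≤ 6 * length F
  event-bound = *-cancelʳ-≤ _ _ 1156
    (≤-trans (≤-trans (≤-reflexive (lhs (countDec event F) s)) (*-monoʳ-≤ (countDec event F) (*-monoʳ-≤ 4 width²)))
    (≤-trans event-bound-width (≤-trans (*-monoˡ-≤ (length F) (m≤m+n 6561 375)) (≤-reflexive (rhs (length F))))))
    where
      lhs : ∀ C s → C * (s * s) * 1156 ≡ C * (4 * ((17 * s) * (17 * s)))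
      lhs = solve-∀
      rhs : ∀ F → 6936 * F ≡ 6 * F * 1156
      rhs = solve-∀
      width² : (17 * s) * (17 * s) ≤ width * width
      width² = *-mono-≤ (*-monoˡ-≤ s (m≤m+n 17 w)) (*-monoˡ-≤ s (m≤m+n 17 w))

short-run-window : ∀ L c hq hy p → c ≤ hq → hq ≤ p → c ≤ hy → hy ≤ p → suc p ∸ c < L →
  (hq + 1 ∸ L ≤ hy) × (hy < hq + L)
short-run-window L c hq hy p c≤hq hq≤p c≤hy hy≤p short = lower , upper
  where
    end< : suc p < c + L
    end< = ≤-<-trans (m≤n+m∸n (suc p) c) (+-monoʳ-< c short)
    lower : hq + 1 ∸ L ≤ hy
    lower = m≤n+o⇒m∸n≤o (hq + 1) L (≤-trans (≤-reflexive (+-comm hq 1)) (≤-trans (s≤s hq≤p)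
              (≤-trans (<⇒≤ end<) (≤-trans (+-monoˡ-≤ L c≤hy) (≤-reflexive (+-comm hy L))))))
    upper : hy < hq + L
    upper = ≤-<-trans hy≤p (<-trans (n<1+n p) (<-≤-trans end< (+-monoˡ-≤ L c≤hq)))

n<2^n : ∀ n → n < 2 ^ n
n<2^n zero = s≤s z≤n
n<2^n (suc n) = ≤-trans (s≤s (n<2^n n)) (≤-trans (+-monoˡ-≤ (2 ^ n) (m^n>0 2 n)) (≤-reflexive (cong (2 ^ n +_) (sym (+-identityʳ (2 ^ n))))))

2^n*2^n : ∀ x → 2 ^ x * 2 ^ x ≡ 4 ^ x
2^n*2^n zero = refl
2^n*2^n (suc x) = trans (ring (2 ^ x)) (cong (4 *_) (2^n*2^n x))
  where ring : ∀ X → 2 * X * (2 * X) ≡ 4 * (X * X)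
        ring = solve-∀

-- A length ℓ ≥ 16 s lies in [16 s 2^i, 32 s 2^i) for some i (fuel bounds the recursion).
dyadic-scale : ∀ fuel s ℓ → 1 ≤ s → 16 * s ≤ ℓ → ℓ < s + fuel → ∃ λ i → 16 * (s * 2 ^ i) ≤ ℓ × ℓ < 32 * (s * 2 ^ i)
dyadic-scale zero s ℓ 1≤s lo hi =
  ⊥-elim (<⇒≱ (<-≤-trans (subst (ℓ <_) (+-identityʳ s) hi) (m≤m+n s (15 * s))) (≤-trans (≤-reflexive (ring s)) lo))
  where ring : ∀ s → s + 15 * s ≡ 16 * s
        ring = solve-∀
dyadic-scale (suc fuel) s ℓ 1≤s lo hi = try (ℓ <? 32 * s)
  where
    double : ∀ s → 16 * (2 * s) ≡ 32 * s
    double = solve-∀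
    regroup : ∀ s f → suc (s + f) ≡ s + 1 + f
    regroup = solve-∀
    shift : ∀ s X → 2 * s * X ≡ s * (2 * X)
    shift = solve-∀
    hi' : ℓ < 2 * s + fuel
    hi' = ≤-trans (subst (ℓ <_) (+-suc s fuel) hi)
          (≤-trans (≤-reflexive (regroup s fuel)) (+-monoˡ-≤ fuel (+-monoʳ-≤ s (≤-trans 1≤s (m≤m+n s 0)))))
    try : Dec (ℓ < 32 * s) → ∃ λ i → 16 * (s * 2 ^ i) ≤ ℓ × ℓ < 32 * (s * 2 ^ i)
    try (yes lt) = 0 , subst (λ z → 16 * z ≤ ℓ) (sym (*-identityʳ s)) lo , subst (λ z → ℓ < 32 * z) (sym (*-identityʳ s)) lt
    try (no ¬lt) = from-double (dyadic-scale fuel (2 * s) ℓ (≤-trans 1≤s (m≤m+n s (s + 0))) (≤-trans (≤-reflexive (double s)) (≮⇒≥ ¬lt)) hi')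
      where
        from-double : (∃ λ i → 16 * (2 * s * 2 ^ i) ≤ ℓ × ℓ < 32 * (2 * s * 2 ^ i)) → ∃ λ i → 16 * (s * 2 ^ i) ≤ ℓ × ℓ < 32 * (s * 2 ^ i)
        from-double (i , p1 , p2) = suc i , subst (λ z → 16 * z ≤ ℓ) (shift s (2 ^ i)) p1 , subst (λ z → ℓ < 32 * z) (shift s (2 ^ i)) p2

round-down-cover : ∀ s .{{_ : NonZero s}} a e → a ≤ e →
  let x₀ = (a / s) * s ; W = (e ∸ x₀) / s + 1 in
  x₀ ≤ a × a ∸ x₀ < s × e ≤ x₀ + W * s × W * s ≤ (e ∸ x₀) + s
round-down-cover s a e a≤e = x₀≤a , a-x₀<s , covers , not-too-wide
  where
    x₀ = (a / s) * s
    m = e ∸ x₀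
    W = m / s + 1
    x₀≤a : x₀ ≤ a
    x₀≤a = m/n*n≤m a s
    a-x₀<s : a ∸ x₀ < s
    a-x₀<s = subst (_< s) (sym (trans (cong (_∸ x₀) (m≡m%n+[m/n]*n a s)) (m+n∸n≡m (a % s) x₀))) (m%n<n a s)
    blocks : ∀ s q → s + q * s ≡ (q + 1) * s
    blocks = solve-∀
    covers : e ≤ x₀ + W * s
    covers = subst (_≤ x₀ + W * s) (m+[n∸m]≡n (≤-trans x₀≤a a≤e))
               (+-monoʳ-≤ x₀ (<⇒≤ (subst (_< W * s) (sym (m≡m%n+[m/n]*n m s))
                                     (≤-trans (+-monoˡ-≤ ((m / s) * s) (m%n<n m s)) (≤-reflexive (blocks s (m / s)))))))
    not-too-wide : W * s ≤ m + s
    not-too-wide = ≤-trans (≤-reflexive (trans (sym (blocks s (m / s))) (+-comm s ((m / s) * s)))) (+-monoˡ-≤ s (m/n*n≤m m s))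

aligned-block : ∀ s .{{_ : NonZero s}} a hq p → a ≤ hq → hq ≤ p → 16 * s ≤ suc p ∸ a → suc p ∸ a < 32 * s →
  Σ ℕ λ o → o < 33 × Σ ℕ λ w → w < 17 ×
    ((hq / s ∸ o) * s ≤ a × suc p ≤ (hq / s ∸ o) * s + (17 + w) * s × 8 * ((17 + w) * s) ≤ 9 * (suc p ∸ a))
aligned-block s a hq p a≤hq hq≤p lo hi =
  o , o<33 , w , w<17 , subst (_≤ a) (sym x≡x₀) x₀≤a , subst (suc p ≤_) (sym (cong₂ _+_ x≡x₀ width≡)) covers , dense
  where
    ℓ = suc p ∸ a
    a≤sp : a ≤ suc p
    a≤sp = ≤-trans a≤hq (≤-trans hq≤p (n≤1+n p))
    cover = round-down-cover s a (suc p) a≤sp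
    x₀ = (a / s) * s
    x₀≤a = proj₁ cover
    a-x₀<s = proj₁ (proj₂ cover)
    covers = proj₁ (proj₂ (proj₂ cover))
    not-too-wide = proj₂ (proj₂ (proj₂ cover))
    m = suc p ∸ x₀
    m≡ : m ≡ ℓ + (a ∸ x₀)
    m≡ = +-cancelʳ-≡ x₀ _ _ (trans (m∸n+n≡m (≤-trans x₀≤a a≤sp))
           (sym (trans (+-assoc ℓ (a ∸ x₀) x₀) (trans (cong (ℓ +_) (m∸n+n≡m x₀≤a)) (m∸n+n≡m a≤sp)))))
    q₁ = m / s
    16≤q₁ : 16 ≤ q₁
    16≤q₁ = subst (_≤ q₁) (m*n/n≡m 16 s) (/-monoˡ-≤ s (≤-trans lo (subst (ℓ ≤_) (sym m≡) (m≤m+n ℓ (a ∸ x₀)))))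
    q₁<33 : q₁ < 33
    q₁<33 = m<n*o⇒m/o<n (subst (_< 33 * s) (sym m≡) (subst (ℓ + (a ∸ x₀) <_) (ring₁ s) (+-mono-< hi a-x₀<s)))
      where ring₁ : ∀ s → 32 * s + s ≡ 33 * s
            ring₁ = solve-∀
    w = q₁ ∸ 16
    w<17 : w < 17
    w<17 = m<n+o⇒m∸n<o q₁ 16 {17} q₁<33
    width≡ : (17 + w) * s ≡ (q₁ + 1) * s
    width≡ = cong (_* s) (trans (cong suc (m+[n∸m]≡n 16≤q₁)) (+-comm 1 q₁))
    o = hq / s ∸ a / s
    x≡x₀ : (hq / s ∸ o) * s ≡ x₀
    x≡x₀ = cong (_* s) (m∸[m∸n]≡n (/-monoˡ-≤ s a≤hq))
    o<33 : o < 33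
    o<33 = m<n+o⇒m∸n<o (hq / s) (a / s) {33} (m<n*o⇒m/o<n hq<)
      where
        ring₂ : ∀ s A → 32 * s + (s + A * s) ≡ (A + 33) * s
        ring₂ = solve-∀
        hq< : hq < (a / s + 33) * s
        hq< = ≤-trans (s≤s hq≤p) (≤-trans (≤-reflexive (sym (m∸n+n≡m a≤sp)))
                (≤-trans (<⇒≤ (+-mono-< hi (subst (_< s + x₀) (m∸n+n≡m x₀≤a) (+-monoˡ-< x₀ a-x₀<s))))
                         (≤-reflexive (ring₂ s (a / s)))))
    dense : 8 * ((17 + w) * s) ≤ 9 * ℓ
    dense = ≤-trans (*-monoʳ-≤ 8 (≤-trans (≤-reflexive width≡) (≤-trans not-too-wide (≤-reflexive (cong (_+ s) m≡)))))
            (≤-trans (≤-reflexive (ring₃ ℓ (a ∸ x₀) s))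
            (≤-trans (+-monoˡ-≤ (8 * s) (+-monoʳ-≤ (8 * ℓ) (*-monoʳ-≤ 8 (<⇒≤ a-x₀<s))))
            (≤-trans (≤-reflexive (ring₄ ℓ s)) (≤-trans (+-monoʳ-≤ (8 * ℓ) lo) (≤-reflexive (ring₅ ℓ))))))
      where
        ring₃ : ∀ ℓ d s → 8 * (ℓ + d + s) ≡ 8 * ℓ + 8 * d + 8 * s
        ring₃ = solve-∀
        ring₄ : ∀ ℓ s → 8 * ℓ + 8 * s + 8 * s ≡ 8 * ℓ + 16 * s
        ring₄ = solve-∀
        ring₅ : ∀ ℓ → 8 * ℓ + ℓ ≡ 9 * ℓ
        ring₅ = solve-∀

-- The final arithmetic: from FP ≤ A + B, A · P ≤ α s Fl, 3 s² B ≤ β Fl and s³ ≤ P ≤ 4 s³,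
-- FP ≤ D s Fl / P ≤ D Fl / P^(2/3), i.e. FP³ P² ≤ D³ Fl³.
combine-bounds : ∀ α β D FP A B Fl s P → FP ≤ A + B → A * P ≤ α * s * Fl → 3 * (s * s) * B ≤ β * Fl →
  P ≤ 4 * (s * (s * s)) → s * (s * s) ≤ P → 1 ≤ P → 3 * α + 4 * β ≤ 3 * D → FP ^ 3 * (P * P) ≤ D ^ 3 * Fl ^ 3
combine-bounds α β D FP A B Fl s P fp A≤ B≤ P≤ s³≤P 1≤P constants =
  *-cancelʳ-≤ _ _ P {{>-nonZero 1≤P}}
    (≤-trans (≤-reflexive (cube FP P))
    (≤-trans (^-monoˡ-≤ 3 FP·P≤)
    (≤-trans (≤-reflexive (cube' D s Fl))
    (≤-trans (*-monoʳ-≤ (D ^ 3) (*-monoˡ-≤ (Fl ^ 3) s³≤P))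
             (≤-reflexive (reorder (D ^ 3) Fl P))))))
  where
    cube : ∀ FP P → FP * (FP * (FP * 1)) * (P * P) * P ≡ (FP * P) * ((FP * P) * ((FP * P) * 1))
    cube = solve-∀
    cube' : ∀ D s Fl → (D * (s * Fl)) * ((D * (s * Fl)) * ((D * (s * Fl)) * 1)) ≡ (D * (D * (D * 1))) * (s * (s * s) * (Fl * (Fl * (Fl * 1))))
    cube' = solve-∀
    reorder : ∀ C Fl P → C * (P * (Fl * (Fl * (Fl * 1)))) ≡ C * (Fl * (Fl * (Fl * 1))) * P
    reorder = solve-∀
    ring₁ : ∀ A B P → 3 * ((A + B) * P) ≡ 3 * (A * P) + 3 * (B * P)
    ring₁ = solve-∀
    ring₂ : ∀ α s Fl B → 3 * (α * s * Fl) + 3 * (B * (4 * (s * (s * s)))) ≡ 3 * α * (s * Fl) + 4 * s * (3 * (s * s) * B)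
    ring₂ = solve-∀
    ring₃ : ∀ α β s Fl → 3 * α * (s * Fl) + 4 * s * (β * Fl) ≡ (3 * α + 4 * β) * (s * Fl)
    ring₃ = solve-∀
    FP·P≤ : FP * P ≤ D * (s * Fl)
    FP·P≤ = *-cancelˡ-≤ 3
      (≤-trans (*-monoʳ-≤ 3 (*-monoˡ-≤ P fp))
      (≤-trans (≤-reflexive (ring₁ A B P))
      (≤-trans (+-mono-≤ (*-monoʳ-≤ 3 A≤) (*-monoʳ-≤ 3 (*-monoʳ-≤ B P≤)))
      (≤-trans (≤-reflexive (ring₂ α s Fl B))
      (≤-trans (+-monoʳ-≤ (3 * α * (s * Fl)) (*-monoʳ-≤ (4 * s) B≤))
      (≤-trans (≤-reflexive (ring₃ α β s Fl))
      (≤-trans (*-monoˡ-≤ (s * Fl) constants) (≤-reflexive (*-assoc 3 D (s * Fl))))))))))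

module SignatureScale (b : ℕ) where
  k : ℕ
  k = b / 3

  s₀ : ℕ
  s₀ = 2 ^ k

  s₀³ : 2 ^ (k * 3) ≡ s₀ * (s₀ * s₀)
  s₀³ = trans (sym (^-*-assoc 2 k 3)) (cong (λ z → s₀ * (s₀ * z)) (*-identityʳ s₀))

  2^b≤ : 2 ^ b ≤ 4 * (s₀ * (s₀ * s₀))
  2^b≤ = subst (_≤ 4 * (s₀ * (s₀ * s₀))) (sym (trans (cong (2 ^_) (m≡m%n+[m/n]*n b 3)) (^-distribˡ-+-* 2 (b % 3) (k * 3))))
           (≤-trans (*-monoˡ-≤ (2 ^ (k * 3)) (^-monoʳ-≤ 2 (≤-pred (m%n<n b 3)))) (≤-reflexive (cong (4 *_) s₀³)))

  ≤2^b : s₀ * (s₀ * s₀) ≤ 2 ^ b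
  ≤2^b = subst (_≤ 2 ^ b) s₀³ (^-monoʳ-≤ 2 (m/n*n≤m b 3))

module FalsePositiveBound {u t b : ℕ} (1≤t : 1 ≤ t) (F : Family u t b) (ind : FiveIndependent F)
                          (S : List (Fin u)) (uqS : Unique S) (3n≤2t : 3 * length S ≤ 2 * t) (q : Fin u) (q∉S : q ∉ S) where
  open SignatureScale b

  n : ℕ
  n = length S

  distinct : Unique (q ∷ S)
  distinct = ¬Any⇒All¬ S q∉S AllPairs.∷ uqS

  L : ℕ
  L = 16 * s₀

  scale : ℕ → ℕ
  scale i = 2 ^ (k + i)

  A : HashFn u t b → Bool
  A = NearbyCollision.event F ind S q q∉S L 1≤t

  Block : ℕ → ℕ → ℕ → HashFn u t b → Bool
  Block i o w = OverfullBlock.event F ind S q distinct 3n≤2t 1≤t (scale i) o w {{m^n≢0 2 (k + i)}}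

  AtScale : ℕ → HashFn u t b → Bool
  AtScale i = anyBelow 33 (λ o → anyBelow 17 (λ w → Block i o w))

  B : HashFn u t b → Bool
  B = anyBelow (suc n) AtScale

  module _ (f : HashFn u t b) (fp : query f (build f S) q ≡ true) where
    open LinearProbing f
    open FalsePositiveWitness (false-positive-witness S q fp)

    short-run⇒A : suc p ∸ c < L → A f ≡ true
    short-run⇒A short = anyOf-intro (NearbyCollision.near F ind S q q∉S L 1≤t) S f y y∈S
                          (∧-intro (eqF-intro same-sig) (inRange-intro (proj₁ window) (proj₂ window)))
      where window = short-run-window L c (h q) (h y) p c≤hq hq≤p c≤hy hy≤p short

    -- A long run [a, p]: its length ℓ picks a dyadic scale s = s₀ 2^i, and an aligned block
    -- around h(q) of width < 34 s is overfull.
    long-run⇒B : L ≤ suc p ∸ c → B f ≡ true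
    long-run⇒B long = anyBelow-intro (suc n) AtScale f i i≤n
                        (anyBelow-intro 33 (λ o' → anyBelow 17 (λ w' → Block i o' w')) f o o<33 (anyBelow-intro 17 (λ w' → Block i o w') f w w<17 overfull))
      where
        ℓ = suc p ∸ a
        L≤ℓ : L ≤ ℓ
        L≤ℓ = ≤-trans long (∸-monoʳ-≤ (suc p) a≤c)
        ℓ≤n : ℓ ≤ n
        ℓ≤n = ≤-trans run-full (count-≤length _ S)
        dyadic = dyadic-scale ℓ s₀ ℓ (m^n>0 2 k) L≤ℓ (≤-trans (s≤s ≤-refl) (+-monoˡ-≤ ℓ (m^n>0 2 k)))
        i = proj₁ dyadic
        s≡ : s₀ * 2 ^ i ≡ scale i
        s≡ = sym (^-distribˡ-+-* 2 k i)
        i≤n : i < suc n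
        i≤n = ≤-trans (n<2^n i) (≤-trans (m≤n*m (2 ^ i) s₀ {{>-nonZero (m^n>0 2 k)}})
                (≤-trans (m≤n*m (s₀ * 2 ^ i) 16) (≤-trans (proj₁ (proj₂ dyadic)) (≤-trans ℓ≤n (n≤1+n n)))))
        instance scale≢0 : NonZero (scale i)
        scale≢0 = m^n≢0 2 (k + i)
        block = aligned-block (scale i) a (h q) p (≤-trans a≤c c≤hq) hq≤p
                  (subst (λ z → 16 * z ≤ ℓ) s≡ (proj₁ (proj₂ dyadic))) (subst (λ z → ℓ < 32 * z) s≡ (proj₂ (proj₂ dyadic)))
        o = proj₁ block
        o<33 = proj₁ (proj₂ block)
        w = proj₁ (proj₂ (proj₂ block))
        w<17 = proj₁ (proj₂ (proj₂ (proj₂ block)))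
        placement = proj₂ (proj₂ (proj₂ (proj₂ block)))
        x = (h q / scale i ∸ o) * scale i
        width = (17 + w) * scale i
        overfull : Block i o w f ≡ true
        overfull = decToBool-intro (8 * width ≤? 9 * keysIn S x (x + width))
          (≤-trans (proj₂ (proj₂ placement))
                   (*-monoʳ-≤ 9 (≤-trans run-full (keysIn-mono S (proj₁ placement) (proj₁ (proj₂ placement))))))

    false-positive⇒A∨B : (A f ∨ B f) ≡ true
    false-positive⇒A∨B = by-length (L ≤? suc p ∸ c)
      where
        by-length : Dec (L ≤ suc p ∸ c) → (A f ∨ B f) ≡ true
        by-length (no short) = ∨-introˡ (short-run⇒A (≰⇒> short))
        by-length (yes long) = ∨-introʳ {A f} (long-run⇒B long)

  A-bound : countDec A F * 2 ^ b ≤ 32 * s₀ * length F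
  A-bound = ≤-trans (NearbyCollision.event-bound F ind S q q∉S L 1≤t (n≤t-from-load n t 3n≤2t))
                    (≤-reflexive (cong (_* length F) (sym (*-assoc 2 16 s₀))))

  AtScale-bound : ∀ i → countDec (AtScale i) F * 4 ^ i * 4 ^ k ≤ 33 * (17 * (6 * length F))
  AtScale-bound i =
    ≤-trans (≤-reflexive (trans (*-assoc (countDec (AtScale i) F) (4 ^ i) (4 ^ k))
                          (cong (countDec (AtScale i) F *_) (trans (*-comm (4 ^ i) (4 ^ k)) (trans (sym (^-distribˡ-+-* 4 k i)) (sym (2^n*2^n (k + i))))))))
    (≤-trans (*-monoˡ-≤ K (≤-trans (union-bound-below 33 (λ o → anyBelow 17 (λ w → Block i o w)) F) (sumBelow-mono 33 (λ o → union-bound-below 17 (λ w → Block i o w) F))))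
    (sumBelow-*ʳ≤ 33 (λ o → sumBelow 17 (λ w → countDec (Block i o w) F)) K (17 * (6 * length F))
       (λ o → sumBelow-*ʳ≤ 17 (λ w → countDec (Block i o w) F) K (6 * length F)
       (λ w → OverfullBlock.event-bound F ind S q distinct 3n≤2t 1≤t (scale i) o w {{m^n≢0 2 (k + i)}}))))
    where K = scale i * scale i

  B-bound : 3 * (s₀ * s₀) * countDec B F ≤ (4 * (33 * (17 * 6))) * length F
  B-bound =
    ≤-trans (*-monoʳ-≤ (3 * (s₀ * s₀)) (union-bound-below (suc n) AtScale F))
    (≤-trans (≤-reflexive (cong (λ z → 3 * z * sumBelow (suc n) (λ i → countDec (AtScale i) F)) (2^n*2^n k)))
    (≤-trans (geometric-sum (suc n) (λ i → countDec (AtScale i) F) (4 ^ k) (33 * (17 * (6 * length F))) AtScale-bound)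
             (≤-reflexive (ring (length F)))))
    where ring : ∀ Fl → 4 * (33 * (17 * (6 * Fl))) ≡ 4 * (33 * (17 * 6)) * Fl
          ring = solve-∀

  -- Pr[FP] ≤ Pr[A] + Pr[B]; the constant is 17984³, where 3 · 32 + 4 · 4 · 33 · 17 · 6 = 3 · 17984.
  bound : falsePositives F S q ^ 3 * 2 ^ (2 * b) ≤ 5816461819904 * length F ^ 3
  bound = subst (λ z → falsePositives F S q ^ 3 * z ≤ 5816461819904 * length F ^ 3) (sym 2^2b)
            (combine-bounds 32 (4 * (33 * (17 * 6))) 17984 (falsePositives F S q) (countDec A F) (countDec B F) (length F) s₀ (2 ^ b)
               (≤-trans (count-mono F false-positive⇒A∨B) (count-∨ A B F)) A-bound B-bound 2^b≤ ≤2^b (m^n>0 2 b) ≤-refl)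
    where
      2^2b : 2 ^ (2 * b) ≡ 2 ^ b * 2 ^ b
      2^2b = trans (^-distribˡ-+-* 2 b (b + 0)) (cong (λ z → 2 ^ b * 2 ^ z) (+-identityʳ b))

theorem7 : ∃ λ (C : ℕ) →
    (u n t b : ℕ) → IsPowerOfTwo t → 3 * n ≤ 2 * t →
    (F : Family u t b) → FiveIndependent F →
    (S : List (Fin u)) → Unique S → length S ≡ n →
    (q : Fin u) → q ∉ S →
    falsePositives F S q ^ 3 * 2 ^ (2 * b) ≤ C * length F ^ 3
theorem7 = 5816461819904 , λ u n t b t-pow 3n≤2t F ind S uqS |S|≡n q q∉S →
  FalsePositiveBound.bound (1≤t t-pow) F ind S uqS (subst (λ z → 3 * z ≤ 2 * t) (sym |S|≡n) 3n≤2t) q q∉S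
  where
    1≤t : ∀ {t} → IsPowerOfTwo t → 1 ≤ t
    1≤t (e , refl) = m^n>0 2 e
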